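{- Let $G$ be a finite group with $|G|>3$ and let $m=|G|-1$. Then: (1) if $\mathcal{Q}$ is a maximum dispersed clique in $\mathscr{G}_m(G)$, then the graph $\mathscr{N}(\mathcal{Q}^*)$ is not regular; (2) if $\mathcal{Q}$ is a maximum interval clique in $\mathscr{G}_m(G)$, then $\mathscr{N}(\mathcal{Q}^*)$ is regular of degree $2m-2$.
   Context: For a finite group $G$ with identity $e$, $G^\times=G\setminus\{e\}$. For $x\in G^\times$ and $1\leqslant k<l\leqslant m+1$, $\mathbf{x}_{[k,l)}\in G^m$ has $j$-th coordinate $x$ for $k\leqslant j<l$ and $e$ otherwise; the interval $\mathcal{S}_{[k,l)}=\{\mathbf{x}_{[k,l)}:x\in G^\times\}$; $\mathcal{S}$ is the union of all intervals, and $\mathscr{G}_m(G)=Cay(G^m,\mathcal{S})$ is the graph on $G^m$ with $\mathbf{g}\sim\mathbf{h}$ iff $\mathbf{h}\mathbf{g}^{ -1}\in\mathcal{S}$. Let $\mathbf{e}=(e,\dots,e)$, $V(\mathbf{e})=\mathcal{S}$ its neighbourhood, and $\mathscr{V}_m(\mathbf{e})$ the subgraph induced on $V(\mathbf{e})$. A clique containing $\mathbf{e}$ is an interval clique if all its vertices other than $\mathbf{e}$ lie in one interval, and a dispersed clique if its vertices other than $\mathbf{e}$ lie in at least two different intervals; a maximum interval (resp. dispersed) clique is one with the largest number of vertices among interval (resp. dispersed) cliques. For such a clique $\mathcal{Q}$, $\mathcal{Q}^*$ is the subgraph induced on its vertices other than $\mathbf{e}$. $\mathscr{N}(\mathcal{Q}^*)$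 is the subgraph of $\mathscr{V}_m(\mathbf{e})$ induced on the set of vertices of $\mathscr{V}_m(\mathbf{e})$ not in $\mathcal{Q}^*$ that are adjacent to at least one vertex of $\mathcal{Q}^*$. -}

module Defs where

open import Level using (0ℓ)
open import Data.Nat using (ℕ; suc; _≤_; _<_; _≤?_; _<?_; _∸_; _*_)
open import Data.Fin using (Fin; toℕ)
open import Data.Bool using (if_then_else_; _∧_)
open import Data.Vec using (Vec; tabulate; zipWith; replicate)
open import Data.List using (List; length)
open import Data.List.Membership.Propositional using (_∈_; _∉_)
open import Data.List.Relation.Unary.Unique.Propositional using (Unique)
open import Data.List.Relation.Unary.AllPairs using (AllPairs)
open import Data.Product using (Σ; ∃; ∃-syntax; _×_)
open import Relation.Nullary using (¬_)
open import Relation.Nullary.Decidable using (⌊_⌋)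
open import Relation.Binary.PropositionalEquality using (_≡_; _≢_)
open import Algebra.Structures using (IsGroup)
open import Function.Bundles using (_⇔_)

-- A finite group of order n, realised on the carrier Fin n with
-- propositional equality (every finite group is isomorphic to such a one).
record FinGroup (n : ℕ) : Set where
  field
    _∙_     : Fin n → Fin n → Fin n
    ε       : Fin n
    _⁻¹     : Fin n → Fin n
    isGroup : IsGroup _≡_ _∙_ ε _⁻¹

HasSize : {A : Set} → (A → Set) → ℕ → Set
HasSize {A} P d =
  Σ (List A) λ L → Unique L × (∀ a → (a ∈ L) ⇔ P a) × (length L ≡ d)

module Graph {n : ℕ} (G : FinGroup n) (m : ℕ) where
  open FinGroup G

  C : Set
  C = Fin n

  Vtx : Set
  Vtx = Vec C m

  𝐞 : Vtx
  𝐞 = replicate m ε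

  -- x_[k,l): j-th coordinate (1-indexed j) is x if k ≤ j < l, else e
  ivec : C → ℕ → ℕ → Vtx
  ivec x k l = tabulate λ j →
    if ⌊ k ≤? suc (toℕ j) ⌋ ∧ ⌊ suc (toℕ j) <? l ⌋ then x else ε

  ValidInterval : ℕ → ℕ → Set
  ValidInterval k l = (1 ≤ k) × (k < l) × (l ≤ suc m)

  InInterval : ℕ → ℕ → Vtx → Set
  InInterval k l v = ∃[ x ] (x ≢ ε) × (v ≡ ivec x k l)

  InS : Vtx → Set
  InS v = ∃[ k ] ∃[ l ] ValidInterval k l × InInterval k l v

  Adj : Vtx → Vtx → Set
  Adj g h = InS (zipWith (λ a b → a ∙ (b ⁻¹)) h g)

  CliqueWithE : List Vtx → Set
  CliqueWithE Q = Unique Q × (𝐞 ∈ Q) × AllPairs Adj Q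

  InQ* : List Vtx → Vtx → Set
  InQ* Q v = (v ∈ Q) × (v ≢ 𝐞)

  IntervalClique : List Vtx → Set
  IntervalClique Q = CliqueWithE Q ×
    ∃[ k ] ∃[ l ] ValidInterval k l × (∀ v → InQ* Q v → InInterval k l v)

  DispersedClique : List Vtx → Set
  DispersedClique Q = CliqueWithE Q ×
    ∃[ u ] ∃[ v ] ∃[ k ] ∃[ l ] ∃[ k' ] ∃[ l' ]
      InQ* Q u × InQ* Q v ×
      ValidInterval k l × ValidInterval k' l' ×
      InInterval k l u × InInterval k' l' v ×
      ¬ (k ≡ k' × l ≡ l')

  MaxIntervalClique : List Vtx → Set
  MaxIntervalClique Q = IntervalClique Q ×
    (∀ Q' → IntervalClique Q' → length Q' ≤ length Q)

  MaxDispersedClique : List Vtx → Set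
  MaxDispersedClique Q = DispersedClique Q ×
    (∀ Q' → DispersedClique Q' → length Q' ≤ length Q)

  InN : List Vtx → Vtx → Set
  InN Q v = InS v × ¬ InQ* Q v × (∃[ u ] InQ* Q u × Adj u v)

  DegreeInN : List Vtx → Vtx → ℕ → Set
  DegreeInN Q v d = HasSize (λ w → InN Q w × Adj v w) d

  RegularOfDegree : List Vtx → ℕ → Set
  RegularOfDegree Q d = ∀ v → InN Q v → DegreeInN Q v d

  RegularN : List Vtx → Set
  RegularN Q = ∃[ d ] RegularOfDegree Q d

-- A vertex x_[k,l) of 𝒱_m(e) is a label x ≠ e on an interval [k, l), i.e. on an edge
-- {k, l} of the complete graph on {1, …, m + 1}. Reading off where the coordinates of
-- y_J x_I⁻¹ change value shows that x_I ∼ y_J exactly when I = J and x ≠ y, or I and J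
-- share one endpoint and y is x (shared start or end) or x⁻¹ (one starts where the
-- other ends); composing these transports is path independent around a vertex and
-- inverts the label around a triangle.
--
-- A maximum interval clique is all of G× on one interval I₀, so 𝒩(Q*) is every vertex
-- on an interval touching I₀; for I₀ = {a, b} the neighbours of y_{ac} in 𝒩(Q*) are the
-- m − 1 other labels on {a, c}, the m − 2 intervals {a, t} and {b, c}: 2m − 2.
--
-- In a dispersed clique two members on touching intervals force all labels, so its
-- intervals form a star at a vertex a or a triangle. A full star is a dispersed clique
-- of size m + 1, so a maximum one is a full star at a, or a triangle with m = 3. If
-- x₀_{ab} is a member of a full star, y_{ab} with y ∉ {x₀, x₀⁻¹} has degree 2m − 3 in
-- 𝒩(Q*), while the transport of x₀ to {b, c} has degree ≥ 2m − 2 or ≤ 2m − 4 according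
-- as x₀² ≠ e or x₀² = e; for a triangle the corresponding degrees are ≥ 3 and ≤ 2.

module Submission where

open import Defs
open import Level using (0ℓ)
open import Algebra.Bundles using (Group)
open import Algebra.Structures using (IsGroup)
open import Data.Bool using (Bool; true; false; not; _∧_; _xor_; if_then_else_)
open import Data.Bool.Properties using (xor-comm; xor-assoc; xor-same; xor-annihilates-not; not-distribˡ-xor; not-involutive)
open import Data.Empty using (⊥; ⊥-elim)
open import Data.Fin using (Fin; toℕ; fromℕ<)
import Data.Fin as Fin
open import Data.Fin.Properties using (toℕ-fromℕ<)
open import Data.List using (List; []; _∷_; length; map; _++_; foldr; applyUpTo; allFin)
open import Data.List.Properties using (length-map; length-++; length-applyUpTo; length-tabulate)
open import Data.List.Membership.Propositional using (_∈_; _∉_; find; lose)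
open import Data.List.Membership.Propositional.Properties
  using (∈-allFin; ∈-applyUpTo⁺; ∈-applyUpTo⁻; ∈-map⁺; ∈-map⁻; ∈-++⁺ˡ; ∈-++⁺ʳ; ∈-++⁻)
import Data.List.Membership.DecPropositional as DecMembership
open import Data.List.Relation.Binary.Subset.Propositional using (_⊆_)
open import Data.List.Relation.Unary.All as All using (All; []; _∷_)
open import Data.List.Relation.Unary.AllPairs using (AllPairs; []; _∷_)
open import Data.List.Relation.Unary.Any using (here; there; any?)
open import Data.List.Relation.Unary.Unique.Propositional using (Unique)
open import Data.List.Relation.Unary.Unique.Propositional.Properties using (allFin⁺; applyUpTo⁺₁; ++⁺)
open import Data.Nat using (ℕ; zero; suc; pred; _+_; _*_; _∸_; _≤_; _<_; _≤?_; _<?_; _≟_; _⊓_; _⊔_; z≤n; s≤s)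
import Data.Nat as ℕ
open import Data.Nat.Properties
  using ( +-comm; +-identityʳ; +-suc; 1+n≰n; <-asym; <-cmp; <-irrefl; <-trans; <-≤-trans; <⇒≤; <⇒≤pred; <⇒≱
        ; m≤n⇒m≤1+n; m≤n⇒m⊓n≡m; m≤n⇒m⊔n≡n; m≥n⇒m⊓n≡n; m≥n⇒m⊔n≡m; n<1+n; n≤1+n; pred[n]≤n; suc-injective
        ; ≤-antisym; ≤-pred; ≤-refl; ≤-reflexive; ≤-trans; ≤∧≢⇒<; ≮⇒≥; ⊓-comm; ⊔-comm; ⊓-idem; ⊔-idem
        ; module ≤-Reasoning )
open import Data.Product using (∃-syntax; _×_; _,_; proj₁; proj₂)
open import Data.Product.Properties using (×-≡,≡←≡) renaming (≡-dec to ×-≡-dec)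
open import Data.Sum using (_⊎_; inj₁; inj₂; [_,_]′; swap)
open import Data.Vec using (Vec; []; _∷_; zipWith; lookup; tabulate)
import Data.Vec as Vec
open import Data.Vec.Properties using (≡-dec; lookup-replicate; lookup∘tabulate; zipWith-replicate₂; map-cong; map-id; tabulate-∘; tabulate-cong)
open import Function using (_∘′_)
open import Function.Bundles using (Equivalence; mk⇔)
open import Relation.Binary.Definitions using (DecidableEquality; tri<; tri≈; tri>)
open import Relation.Binary.PropositionalEquality using (_≡_; _≢_; refl; sym; trans; cong; cong₂; subst; subst₂; module ≡-Reasoning)
open import Relation.Nullary using (¬_; ¬?; Dec; yes; no)
open import Relation.Nullary.Decidable using (⌊_⌋; _⊎-dec_)

module _ {A : Set} where

  unique-map⁺ : ∀ {B : Set} {g : A → B} (xs : List A) → Unique xs →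
                (∀ {x y} → x ∈ xs → y ∈ xs → g x ≡ g y → x ≡ y) → Unique (map g xs)
  unique-map⁺ [] _ _ = []
  unique-map⁺ {g = g} (x ∷ xs) (x∉ ∷ u) inj =
    head-distinct xs x∉ (λ y∈ → inj (here refl) (there y∈)) ∷ unique-map⁺ xs u (λ p q → inj (there p) (there q))
    where
      head-distinct : ∀ ys → All (x ≢_) ys → (∀ {y} → y ∈ ys → g x ≡ g y → x ≡ y) → All (g x ≢_) (map g ys)
      head-distinct [] [] _ = []
      head-distinct (y ∷ ys) (x≢y ∷ x≢ys) inj′ = (λ e → x≢y (inj′ (here refl) e)) ∷ head-distinct ys x≢ys (λ p → inj′ (there p))

  allPairs-map⁺ : ∀ {B : Set} {R : B → B → Set} {g : A → B} (xs : List A) → Unique xs →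
                  (∀ {x y} → x ∈ xs → y ∈ xs → x ≢ y → R (g x) (g y)) → AllPairs R (map g xs)
  allPairs-map⁺ [] _ _ = []
  allPairs-map⁺ {R = R} {g} (x ∷ xs) (x∉ ∷ u) rel =
    head-related xs x∉ (λ y∈ → rel (here refl) (there y∈)) ∷ allPairs-map⁺ xs u (λ p q → rel (there p) (there q))
    where
      head-related : ∀ ys → All (x ≢_) ys → (∀ {y} → y ∈ ys → x ≢ y → R (g x) (g y)) → All (R (g x)) (map g ys)
      head-related [] [] _ = []
      head-related (y ∷ ys) (x≢y ∷ x≢ys) rel′ = rel′ (here refl) x≢y ∷ head-related ys x≢ys (λ p → rel′ (there p))

  allPairs-lookup : ∀ {R : A → A → Set} {xs u w} → AllPairs R xs → u ∈ xs → w ∈ xs → u ≢ w → R u w ⊎ R w u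
  allPairs-lookup (_ ∷ _) (here refl) (here refl) u≢w = ⊥-elim (u≢w refl)
  allPairs-lookup (r ∷ _) (here refl) (there w∈) _ = inj₁ (All.lookup r w∈)
  allPairs-lookup (r ∷ _) (there u∈) (here refl) _ = inj₂ (All.lookup r u∈)
  allPairs-lookup (_ ∷ rs) (there u∈) (there w∈) u≢w = allPairs-lookup rs u∈ w∈ u≢w

module Counting {A : Set} (_≟_ : DecidableEquality A) where

  open DecMembership _≟_ public using (_∈?_)

  remove : A → List A → List A
  remove p [] = []
  remove p (y ∷ ys) with y ≟ p
  ... | yes _ = remove p ys
  ... | no _ = y ∷ remove p ys

  ∈-remove⁻ : ∀ p {t} ys → t ∈ remove p ys → t ∈ ys × t ≢ p
  ∈-remove⁻ p (y ∷ ys) t∈ with y ≟ p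
  ... | yes _ = there (proj₁ (∈-remove⁻ p ys t∈)) , proj₂ (∈-remove⁻ p ys t∈)
  ∈-remove⁻ p (y ∷ ys) (here refl) | no y≢p = here refl , y≢p
  ∈-remove⁻ p (y ∷ ys) (there t∈) | no _ = there (proj₁ (∈-remove⁻ p ys t∈)) , proj₂ (∈-remove⁻ p ys t∈)

  ∈-remove⁺ : ∀ p {t} ys → t ∈ ys → t ≢ p → t ∈ remove p ys
  ∈-remove⁺ p (y ∷ ys) t∈ t≢p with y ≟ p
  ∈-remove⁺ p (y ∷ ys) (here refl) t≢p | yes y≡p = ⊥-elim (t≢p y≡p)
  ∈-remove⁺ p (y ∷ ys) (there t∈) t≢p | yes _ = ∈-remove⁺ p ys t∈ t≢p
  ∈-remove⁺ p (y ∷ ys) (here refl) t≢p | no _ = here refl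
  ∈-remove⁺ p (y ∷ ys) (there t∈) t≢p | no _ = there (∈-remove⁺ p ys t∈ t≢p)

  unique-remove⁺ : ∀ p ys → Unique ys → Unique (remove p ys)
  unique-remove⁺ p [] [] = []
  unique-remove⁺ p (y ∷ ys) (y∉ ∷ u) with y ≟ p
  ... | yes _ = unique-remove⁺ p ys u
  ... | no _ = All.tabulate (λ t∈ → All.lookup y∉ (proj₁ (∈-remove⁻ p ys t∈))) ∷ unique-remove⁺ p ys u

  remove-∉ : ∀ {p} ys → p ∉ ys → remove p ys ≡ ys
  remove-∉ [] _ = refl
  remove-∉ {p} (y ∷ ys) p∉ with y ≟ p
  ... | yes y≡p = ⊥-elim (p∉ (here (sym y≡p)))
  ... | no _ = cong (y ∷_) (remove-∉ ys (λ p∈ → p∉ (there p∈)))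

  length-remove≤ : ∀ p ys → length (remove p ys) ≤ length ys
  length-remove≤ p [] = z≤n
  length-remove≤ p (y ∷ ys) with y ≟ p
  ... | yes _ = m≤n⇒m≤1+n (length-remove≤ p ys)
  ... | no _ = s≤s (length-remove≤ p ys)

  length-remove< : ∀ p ys → p ∈ ys → length (remove p ys) < length ys
  length-remove< p (y ∷ ys) p∈ with y ≟ p
  ... | yes _ = s≤s (length-remove≤ p ys)
  length-remove< p (y ∷ ys) (here refl) | no y≢y = ⊥-elim (y≢y refl)
  length-remove< p (y ∷ ys) (there p∈) | no _ = s≤s (length-remove< p ys p∈)

  length-remove : ∀ p ys → Unique ys → p ∈ ys → suc (length (remove p ys)) ≡ length ys
  length-remove p (y ∷ ys) (y∉ ∷ u) p∈ with y ≟ p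
  ... | yes refl = cong (suc ∘′ length) (remove-∉ ys (λ p∈′ → All.lookup y∉ p∈′ refl))
  length-remove p (y ∷ ys) (_ ∷ _) (here refl) | no y≢y = ⊥-elim (y≢y refl)
  length-remove p (y ∷ ys) (_ ∷ u) (there p∈) | no _ = cong suc (length-remove p ys u p∈)

  removeAll : List A → List A → List A
  removeAll ps ys = foldr remove ys ps

  ∈-removeAll⁻ : ∀ ps {t} ys → t ∈ removeAll ps ys → t ∈ ys × t ∉ ps
  ∈-removeAll⁻ [] ys t∈ = t∈ , λ ()
  ∈-removeAll⁻ (p ∷ ps) ys t∈ with ∈-remove⁻ p (removeAll ps ys) t∈
  ... | t∈′ , t≢p = proj₁ (∈-removeAll⁻ ps ys t∈′) ,
                     λ { (here t≡p) → t≢p t≡p ; (there t∈ps) → proj₂ (∈-removeAll⁻ ps ys t∈′) t∈ps }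

  ∈-removeAll⁺ : ∀ ps {t} ys → t ∈ ys → t ∉ ps → t ∈ removeAll ps ys
  ∈-removeAll⁺ [] ys t∈ _ = t∈
  ∈-removeAll⁺ (p ∷ ps) ys t∈ t∉ = ∈-remove⁺ p (removeAll ps ys) (∈-removeAll⁺ ps ys t∈ (t∉ ∘′ there)) (t∉ ∘′ here)

  unique-removeAll⁺ : ∀ ps ys → Unique ys → Unique (removeAll ps ys)
  unique-removeAll⁺ [] ys u = u
  unique-removeAll⁺ (p ∷ ps) ys u = unique-remove⁺ p (removeAll ps ys) (unique-removeAll⁺ ps ys u)

  length-removeAll : ∀ ps ys → Unique ps → Unique ys → ps ⊆ ys → length ps + length (removeAll ps ys) ≡ length ys
  length-removeAll [] ys _ _ _ = refl
  length-removeAll (p ∷ ps) ys (p∉ps ∷ ups) uys ps⊆ys =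
    trans (sym (+-suc (length ps) _)) (trans (cong (length ps +_) (length-remove p (removeAll ps ys) (unique-removeAll⁺ ps ys uys) p∈))
          (length-removeAll ps ys ups uys (ps⊆ys ∘′ there)))
    where
      p∈ : p ∈ removeAll ps ys
      p∈ = ∈-removeAll⁺ ps ys (ps⊆ys (here refl)) (λ p∈ps → All.lookup p∉ps p∈ps refl)

  unique⊆⇒length≤ : ∀ xs ys → Unique xs → xs ⊆ ys → length xs ≤ length ys
  unique⊆⇒length≤ [] ys _ _ = z≤n
  unique⊆⇒length≤ (x ∷ xs) ys (x∉ ∷ u) xs⊆ys =
    ≤-trans (s≤s (unique⊆⇒length≤ xs (remove x ys) u xs⊆ys-x)) (length-remove< x ys (xs⊆ys (here refl)))
    where
      xs⊆ys-x : xs ⊆ remove x ys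
      xs⊆ys-x t∈ = ∈-remove⁺ x ys (xs⊆ys (there t∈)) (λ t≡x → All.lookup x∉ t∈ (sym t≡x))

  unique⊆∧length≥⇒⊇ : ∀ xs ys → Unique xs → xs ⊆ ys → length ys ≤ length xs → ys ⊆ xs
  unique⊆∧length≥⇒⊇ xs ys u xs⊆ys |ys|≤|xs| {t} t∈ys with t ∈? xs
  ... | yes t∈xs = t∈xs
  ... | no t∉xs = ⊥-elim (<-irrefl refl (≤-trans (unique⊆⇒length≤ (t ∷ xs) ys (t∉ ∷ u) t∷xs⊆ys) |ys|≤|xs|))
    where
      t∉ : All (t ≢_) xs
      t∉ = All.tabulate λ { x∈ refl → t∉xs x∈ }
      t∷xs⊆ys : (t ∷ xs) ⊆ ys
      t∷xs⊆ys (here refl) = t∈ys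
      t∷xs⊆ys (there x∈) = xs⊆ys x∈

  longer⇒∃∉ : ∀ xs ys → Unique xs → length ys < length xs → ∃[ x ] x ∈ xs × x ∉ ys
  longer⇒∃∉ xs ys u |ys|<|xs| with any? (λ x → ¬? (x ∈? ys)) xs
  ... | yes some = find some
  ... | no none = ⊥-elim (<⇒≱ |ys|<|xs| (unique⊆⇒length≤ xs ys u xs⊆ys))
    where
      xs⊆ys : xs ⊆ ys
      xs⊆ys {x} x∈ with x ∈? ys
      ... | yes x∈ys = x∈ys
      ... | no x∉ys = ⊥-elim (none (lose x∈ x∉ys))

  size≤length : ∀ {P : A → Set} {d} → HasSize P d → (M : List A) → (∀ a → P a → a ∈ M) → d ≤ length M
  size≤length (L , u , L⇔P , refl) M P⊆M = unique⊆⇒length≤ L M u (λ {t} t∈ → P⊆M t (Equivalence.to (L⇔P t) t∈))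

  length≤size : ∀ {P : A → Set} {d} → HasSize P d → (L : List A) → Unique L → (∀ a → a ∈ L → P a) → length L ≤ d
  length≤size (L′ , _ , L′⇔P , refl) L u L⊆P = unique⊆⇒length≤ L L′ u (λ {t} t∈ → Equivalence.from (L′⇔P t) (L⊆P t t∈))

<⊎≥ : ∀ j q → j < q ⊎ q ≤ j
<⊎≥ j q with j <? q
... | yes j<q = inj₁ j<q
... | no j≮q = inj₂ (≮⇒≥ j≮q)

<⇒pred< : ∀ {k l} → k < l → pred l < l
<⇒pred< (s≤s _) = ≤-refl

zipWith-tabulate : ∀ {A B C : Set} {k} (g : A → B → C) (F : Fin k → A) (H : Fin k → B) →
                   zipWith g (tabulate F) (tabulate H) ≡ tabulate (λ i → g (F i) (H i))
zipWith-tabulate {k = zero} g F H = refl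
zipWith-tabulate {k = suc k} g F H = cong (g (F Fin.zero) (H Fin.zero) ∷_) (zipWith-tabulate g (F ∘′ Fin.suc) (H ∘′ Fin.suc))

tabulate-suc-agree : ∀ {A : Set} k (F H : ℕ → A) →
  tabulate {n = k} (λ i → F (suc (toℕ i))) ≡ tabulate (λ i → H (suc (toℕ i))) →
  F 0 ≡ H 0 → F (suc k) ≡ H (suc k) → ∀ j → j ≤ suc k → F j ≡ H j
tabulate-suc-agree k F H eq F0 Fk zero _ = F0
tabulate-suc-agree k F H eq F0 Fk (suc q) q<1+k with q <? k
... | yes q<k = subst (λ t → F (suc t) ≡ H (suc t)) (toℕ-fromℕ< q<k)
      (trans (sym (lookup∘tabulate _ (fromℕ< q<k))) (trans (cong (λ v → lookup v (fromℕ< q<k)) eq) (lookup∘tabulate _ (fromℕ< q<k))))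
... | no q≮k with ≤-antisym (≤-pred q<1+k) (≮⇒≥ q≮k)
...   | refl = Fk

module IntervalVectors {n : ℕ} (G : FinGroup n) (m : ℕ) where
  open FinGroup G public
  open Graph G m public
  open IsGroup isGroup public using (_//_; inverseʳ)

  group : Group 0ℓ 0ℓ
  group = record { isGroup = isGroup }

  open import Algebra.Properties.Group group public
    using (ε⁻¹≈ε; ⁻¹-involutive; ⁻¹-injective; x∙y⁻¹≈ε⇒x≈y; ∙-cancelˡ; ∙-cancelʳ)

  ε//ε : ε // ε ≡ ε
  ε//ε = inverseʳ ε

  x//ε : ∀ x → x // ε ≡ x
  x//ε x = trans (cong (x ∙_) ε⁻¹≈ε) (IsGroup.identityʳ isGroup x)

  ε//x : ∀ x → ε // x ≡ x ⁻¹
  ε//x x = IsGroup.identityˡ isGroup (x ⁻¹)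

  ⁻¹≢ε : ∀ {x} → x ≢ ε → x ⁻¹ ≢ ε
  ⁻¹≢ε x≢ε eq = x≢ε (⁻¹-injective (trans eq (sym ε⁻¹≈ε)))

  -- Coordinate j of x_[k,l), for every j ∈ ℕ (1-indexed, so 0 and m + 1 lie outside every interval).
  opaque
    coord : C → ℕ → ℕ → ℕ → C
    coord x k l j = if ⌊ k ≤? j ⌋ ∧ ⌊ j <? l ⌋ then x else ε

    coord-inside : ∀ x {k l j} → k ≤ j → j < l → coord x k l j ≡ x
    coord-inside x {k} {l} {j} k≤j j<l with k ≤? j | j <? l
    ... | yes _ | yes _ = refl
    ... | no k≰j | _ = ⊥-elim (k≰j k≤j)
    ... | yes _ | no j≮l = ⊥-elim (j≮l j<l)

    coord-below : ∀ x {k l j} → j < k → coord x k l j ≡ ε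
    coord-below x {k} {l} {j} j<k with k ≤? j
    ... | yes k≤j = ⊥-elim (<⇒≱ j<k k≤j)
    ... | no _ = refl

    coord-above : ∀ x {k l j} → l ≤ j → coord x k l j ≡ ε
    coord-above x {k} {l} {j} l≤j with k ≤? j | j <? l
    ... | yes _ | yes j<l = ⊥-elim (<⇒≱ j<l l≤j)
    ... | yes _ | no _ = refl
    ... | no _ | _ = refl

    coord-ε : ∀ k l j → coord ε k l j ≡ ε
    coord-ε k l j with ⌊ k ≤? j ⌋ ∧ ⌊ j <? l ⌋
    ... | true = refl
    ... | false = refl

    coord-// : ∀ y x k l j → coord y k l j // coord x k l j ≡ coord (y // x) k l j
    coord-// y x k l j with ⌊ k ≤? j ⌋ ∧ ⌊ j <? l ⌋
    ... | true = refl
    ... | false = ε//ε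

    coord-⁻¹ : ∀ x k l j → coord x k l j ⁻¹ ≡ coord (x ⁻¹) k l j
    coord-⁻¹ x k l j with ⌊ k ≤? j ⌋ ∧ ⌊ j <? l ⌋
    ... | true = refl
    ... | false = ε⁻¹≈ε

    ivec≡tabulate-coord : ∀ x k l → ivec x k l ≡ tabulate (λ i → coord x k l (suc (toℕ i)))
    ivec≡tabulate-coord x k l = refl

  -- The vector that is α on [p, q) and β on [q, r); every difference of two
  -- adjacent interval vectors is computed on such two-piece vectors.
  piece : C → C → ℕ → ℕ → ℕ → ℕ → C
  piece α β p q r j = if ⌊ j <? q ⌋ then coord α p q j else coord β q r j

  piece-< : ∀ α β {p q r j} → j < q → piece α β p q r j ≡ coord α p q j
  piece-< α β {q = q} {j = j} j<q with j <? q
  ... | yes _ = refl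
  ... | no j≮q = ⊥-elim (j≮q j<q)

  piece-≥ : ∀ α β {p q r j} → q ≤ j → piece α β p q r j ≡ coord β q r j
  piece-≥ α β {q = q} {j = j} q≤j with j <? q
  ... | yes j<q = ⊥-elim (<⇒≱ j<q q≤j)
  ... | no _ = refl

  piece-// : ∀ α β α′ β′ p q r j → piece α β p q r j // piece α′ β′ p q r j ≡ piece (α // α′) (β // β′) p q r j
  piece-// α β α′ β′ p q r j with <⊎≥ j q
  ... | inj₁ j<q = trans (cong₂ _//_ (piece-< α β j<q) (piece-< α′ β′ j<q))
                     (trans (coord-// α α′ p q j) (sym (piece-< (α // α′) (β // β′) j<q)))
  ... | inj₂ q≤j = trans (cong₂ _//_ (piece-≥ α β q≤j) (piece-≥ α′ β′ q≤j))
                     (trans (coord-// β β′ q r j) (sym (piece-≥ (α // α′) (β // β′) q≤j)))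

  coord≡piece-whole : ∀ x {p q r} → p ≤ q → q ≤ r → ∀ j → coord x p r j ≡ piece x x p q r j
  coord≡piece-whole x {p} {q} {r} p≤q q≤r j with <⊎≥ j q | <⊎≥ j p | <⊎≥ j r
  ... | inj₁ j<q | inj₁ j<p | _ = trans (coord-below x j<p) (sym (trans (piece-< x x j<q) (coord-below x j<p)))
  ... | inj₁ j<q | inj₂ p≤j | _ = trans (coord-inside x p≤j (<-≤-trans j<q q≤r)) (sym (trans (piece-< x x j<q) (coord-inside x p≤j j<q)))
  ... | inj₂ q≤j | _ | inj₁ j<r = trans (coord-inside x (≤-trans p≤q q≤j) j<r) (sym (trans (piece-≥ x x q≤j) (coord-inside x q≤j j<r)))
  ... | inj₂ q≤j | _ | inj₂ r≤j = trans (coord-above x r≤j) (sym (trans (piece-≥ x x q≤j) (coord-above x r≤j)))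

  coord≡piece-left : ∀ x p q r j → coord x p q j ≡ piece x ε p q r j
  coord≡piece-left x p q r j with <⊎≥ j q
  ... | inj₁ j<q = sym (piece-< x ε j<q)
  ... | inj₂ q≤j = trans (coord-above x q≤j) (sym (trans (piece-≥ x ε q≤j) (coord-ε q r j)))

  coord≡piece-right : ∀ x p q r j → coord x q r j ≡ piece ε x p q r j
  coord≡piece-right x p q r j with <⊎≥ j q
  ... | inj₁ j<q = trans (coord-below x j<q) (sym (trans (piece-< ε x j<q) (coord-ε p q j)))
  ... | inj₂ q≤j = sym (piece-≥ ε x q≤j)

  difference-of-pieces : ∀ {Y X : ℕ → C} {α β α′ β′ γ δ} p q r →
    (∀ j → Y j ≡ piece α β p q r j) → (∀ j → X j ≡ piece α′ β′ p q r j) →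
    α // α′ ≡ γ → β // β′ ≡ δ → ∀ j → Y j // X j ≡ piece γ δ p q r j
  difference-of-pieces {α = α} {β} {α′} {β′} p q r Y≡ X≡ γ≡ δ≡ j =
    trans (cong₂ _//_ (Y≡ j) (X≡ j)) (trans (piece-// α β α′ β′ p q r j) (cong₂ (λ γ δ → piece γ δ p q r j) γ≡ δ≡))

  adjacent-by-difference : ∀ x k l y k′ l′ z a b → ValidInterval a b → z ≢ ε →
    (∀ j → coord y k′ l′ j // coord x k l j ≡ coord z a b j) → Adj (ivec x k l) (ivec y k′ l′)
  adjacent-by-difference x k l y k′ l′ z a b valid z≢ε diff =
    a , b , valid , z , z≢ε , (begin
      zipWith _//_ (ivec y k′ l′) (ivec x k l)
        ≡⟨ cong₂ (zipWith _//_) (ivec≡tabulate-coord y k′ l′) (ivec≡tabulate-coord x k l) ⟩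
      zipWith _//_ (tabulate (λ i → coord y k′ l′ (suc (toℕ i)))) (tabulate (λ i → coord x k l (suc (toℕ i))))
        ≡⟨ zipWith-tabulate _//_ _ _ ⟩
      tabulate (λ i → coord y k′ l′ (suc (toℕ i)) // coord x k l (suc (toℕ i)))
        ≡⟨ tabulate-cong (λ i → diff (suc (toℕ i))) ⟩
      tabulate (λ i → coord z a b (suc (toℕ i)))
        ≡⟨ sym (ivec≡tabulate-coord z a b) ⟩
      ivec z a b ∎)
    where open ≡-Reasoning

  data Configuration (x : C) (k l : ℕ) (y : C) (k′ l′ : ℕ) : Set where
    same-interval : k ≡ k′ → l ≡ l′ → x ≢ y → Configuration x k l y k′ l′
    same-start    : k ≡ k′ → l ≢ l′ → y ≡ x → Configuration x k l y k′ l′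
    same-end      : l ≡ l′ → k ≢ k′ → y ≡ x → Configuration x k l y k′ l′
    abut-right    : l ≡ k′ → y ≡ x ⁻¹ → Configuration x k l y k′ l′
    abut-left     : l′ ≡ k → y ≡ x ⁻¹ → Configuration x k l y k′ l′

  configuration⇒adjacent : ∀ x k l y k′ l′ → ValidInterval k l → ValidInterval k′ l′ → x ≢ ε →
    Configuration x k l y k′ l′ → Adj (ivec x k l) (ivec y k′ l′)
  configuration⇒adjacent x k l y _ _ (1≤k , k<l , l≤) _ _ (same-interval refl refl x≢y) =
    adjacent-by-difference x k l y k l (y // x) k l (1≤k , k<l , l≤) (λ e → x≢y (sym (x∙y⁻¹≈ε⇒x≈y y x e))) (coord-// y x k l)
  configuration⇒adjacent x k l _ _ l′ (1≤k , k<l , l≤) (_ , k<l′ , l′≤) x≢ε (same-start refl l≢l′ refl) with <-cmp l l′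
  ... | tri< l<l′ _ _ = adjacent-by-difference x k l x k l′ x l l′ (≤-trans 1≤k (<⇒≤ k<l) , l<l′ , l′≤) x≢ε
          (λ j → trans (difference-of-pieces k l l′ (coord≡piece-whole x (<⇒≤ k<l) (<⇒≤ l<l′)) (coord≡piece-left x k l l′)
                                                 (inverseʳ x) (x//ε x) j)
                       (sym (coord≡piece-right x k l l′ j)))
  ... | tri≈ _ l≡l′ _ = ⊥-elim (l≢l′ l≡l′)
  ... | tri> _ _ l′<l = adjacent-by-difference x k l x k l′ (x ⁻¹) l′ l (≤-trans 1≤k (<⇒≤ k<l′) , l′<l , l≤) (⁻¹≢ε x≢ε)
          (λ j → trans (difference-of-pieces k l′ l (coord≡piece-left x k l′ l) (coord≡piece-whole x (<⇒≤ k<l′) (<⇒≤ l′<l))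
                                                 (inverseʳ x) (ε//x x) j)
                       (sym (coord≡piece-right (x ⁻¹) k l′ l j)))
  configuration⇒adjacent x k l _ k′ _ (1≤k , k<l , l≤) (1≤k′ , k′<l , _) x≢ε (same-end refl k≢k′ refl) with <-cmp k k′
  ... | tri< k<k′ _ _ = adjacent-by-difference x k l x k′ l (x ⁻¹) k k′ (1≤k , k<k′ , ≤-trans (<⇒≤ k′<l) l≤) (⁻¹≢ε x≢ε)
          (λ j → trans (difference-of-pieces k k′ l (coord≡piece-right x k k′ l) (coord≡piece-whole x (<⇒≤ k<k′) (<⇒≤ k′<l))
                                                 (ε//x x) (inverseʳ x) j)
                       (sym (coord≡piece-left (x ⁻¹) k k′ l j)))
  ... | tri≈ _ k≡k′ _ = ⊥-elim (k≢k′ k≡k′)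
  ... | tri> _ _ k′<k = adjacent-by-difference x k l x k′ l x k′ k (1≤k′ , k′<k , ≤-trans (<⇒≤ k<l) l≤) x≢ε
          (λ j → trans (difference-of-pieces k′ k l (coord≡piece-whole x (<⇒≤ k′<k) (<⇒≤ k<l)) (coord≡piece-right x k′ k l)
                                                 (x//ε x) (inverseʳ x) j)
                       (sym (coord≡piece-left x k′ k l j)))
  configuration⇒adjacent x k l _ _ l′ (1≤k , k<l , _) (_ , l<l′ , l′≤) x≢ε (abut-right refl refl) =
    adjacent-by-difference x k l (x ⁻¹) l l′ (x ⁻¹) k l′ (1≤k , <-trans k<l l<l′ , l′≤) (⁻¹≢ε x≢ε)
      (λ j → trans (difference-of-pieces k l l′ (coord≡piece-right (x ⁻¹) k l l′) (coord≡piece-left x k l l′) (ε//x x) (x//ε (x ⁻¹)) j)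
                   (sym (coord≡piece-whole (x ⁻¹) (<⇒≤ k<l) (<⇒≤ l<l′) j)))
  configuration⇒adjacent x k l _ k′ _ (_ , k<l , l≤) (1≤k′ , k′<k , _) x≢ε (abut-left refl refl) =
    adjacent-by-difference x k l (x ⁻¹) k′ k (x ⁻¹) k′ l (1≤k′ , <-trans k′<k k<l , l≤) (⁻¹≢ε x≢ε)
      (λ j → trans (difference-of-pieces k′ k l (coord≡piece-left (x ⁻¹) k′ k l) (coord≡piece-right x k′ k l) (x//ε (x ⁻¹)) (ε//x x) j)
                   (sym (coord≡piece-whole (x ⁻¹) (<⇒≤ k′<k) (<⇒≤ k<l) j)))

  Endpoint : ℕ → ℕ → ℕ → Set
  Endpoint k l p = p ≡ k ⊎ p ≡ l

  endpoint? : ∀ k l p → Dec (Endpoint k l p)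
  endpoint? k l p = (p ≟ k) ⊎-dec (p ≟ l)

  coord-jump : ∀ x {k l q} → x ≢ ε → k < l → Endpoint k l (suc q) → coord x k l q ≢ coord x k l (suc q)
  coord-jump x x≢ε k<l (inj₁ refl) eq = x≢ε (trans (sym (coord-inside x ≤-refl k<l)) (trans (sym eq) (coord-below x ≤-refl)))
  coord-jump x x≢ε k<l (inj₂ refl) eq = x≢ε (trans (sym (coord-inside x (≤-pred k<l) ≤-refl)) (trans eq (coord-above x ≤-refl)))

  coord-flat : ∀ x {k l q} → ¬ Endpoint k l (suc q) → coord x k l q ≡ coord x k l (suc q)
  coord-flat x {k} {l} {q} ¬end with <-cmp (suc q) k | <-cmp (suc q) l
  ... | tri≈ _ e _ | _ = ⊥-elim (¬end (inj₁ e))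
  ... | _ | tri≈ _ e _ = ⊥-elim (¬end (inj₂ e))
  ... | tri< 1+q<k _ _ | _ = trans (coord-below x (<-trans (n<1+n q) 1+q<k)) (sym (coord-below x 1+q<k))
  ... | tri> _ _ k<1+q | tri< 1+q<l _ _ = trans (coord-inside x (≤-pred k<1+q) (<-trans (n<1+n q) 1+q<l)) (sym (coord-inside x (<⇒≤ k<1+q) 1+q<l))
  ... | tri> _ _ _ | tri> _ _ l<1+q = trans (coord-above x (≤-pred l<1+q)) (sym (coord-above x (<⇒≤ l<1+q)))

  endpoint≥1 : ∀ {k l p} → ValidInterval k l → Endpoint k l p → 1 ≤ p
  endpoint≥1 (1≤k , _ , _) (inj₁ refl) = 1≤k
  endpoint≥1 (1≤k , k<l , _) (inj₂ refl) = ≤-trans 1≤k (<⇒≤ k<l)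

  endpoint≤ : ∀ {k l p} → ValidInterval k l → Endpoint k l p → p ≤ suc m
  endpoint≤ (_ , k<l , l≤) (inj₁ refl) = ≤-trans (<⇒≤ k<l) l≤
  endpoint≤ (_ , _ , l≤) (inj₂ refl) = l≤

  endpoints-ordered : ∀ {a b p p′} → a < b → Endpoint a b p → Endpoint a b p′ → p < p′ → p ≡ a × p′ ≡ b
  endpoints-ordered a<b (inj₁ refl) (inj₁ refl) p<p′ = ⊥-elim (<-irrefl refl p<p′)
  endpoints-ordered a<b (inj₁ p≡a) (inj₂ p′≡b) _ = p≡a , p′≡b
  endpoints-ordered a<b (inj₂ refl) (inj₁ refl) p<p′ = ⊥-elim (<-asym a<b p<p′)
  endpoints-ordered a<b (inj₂ refl) (inj₂ refl) p<p′ = ⊥-elim (<-irrefl refl p<p′)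

  other-endpoint : ∀ {k l a b p} → p ≢ k → p ≢ l → Endpoint k l p ⊎ Endpoint a b p → Endpoint a b p
  other-endpoint p≢k _ (inj₁ (inj₁ p≡k)) = ⊥-elim (p≢k p≡k)
  other-endpoint _ p≢l (inj₁ (inj₂ p≡l)) = ⊥-elim (p≢l p≡l)
  other-endpoint _ _ (inj₂ end) = end

  -- If y_J x_I⁻¹ = z_K then every endpoint of I is one of J or of K (and vice
  -- versa), since coordinatewise y = z x changes value only where z or x does.
  module Forward (x y z : C) (k l k′ l′ a b : ℕ)
                 (vI : ValidInterval k l) (vJ : ValidInterval k′ l′) (vK : ValidInterval a b)
                 (x≢ε : x ≢ ε) (y≢ε : y ≢ ε) (z≢ε : z ≢ ε)
                 (eq : zipWith _//_ (ivec y k′ l′) (ivec x k l) ≡ ivec z a b) where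

    D : ℕ → C
    D j = coord y k′ l′ j // coord x k l j

    D≡z : ∀ j → j ≤ suc m → D j ≡ coord z a b j
    D≡z = tabulate-suc-agree m D (coord z a b)
      (trans (sym (zipWith-tabulate _//_ _ _))
        (trans (sym (cong₂ (zipWith _//_) (ivec≡tabulate-coord y k′ l′) (ivec≡tabulate-coord x k l)))
          (trans eq (ivec≡tabulate-coord z a b))))
      (trans (cong₂ _//_ (coord-below y (proj₁ vJ)) (coord-below x (proj₁ vI))) (trans ε//ε (sym (coord-below z (proj₁ vK)))))
      (trans (cong₂ _//_ (coord-above y (proj₂ (proj₂ vJ))) (coord-above x (proj₂ (proj₂ vI))))
             (trans ε//ε (sym (coord-above z (proj₂ (proj₂ vK))))))

    D-flat : ∀ q → suc q ≤ suc m → ¬ Endpoint a b (suc q) → D q ≡ D (suc q)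
    D-flat q 1+q≤ ¬end = trans (D≡z q (≤-trans (n≤1+n q) 1+q≤)) (trans (coord-flat z ¬end) (sym (D≡z (suc q) 1+q≤)))

    x-endpoint : ∀ p → Endpoint k l p → Endpoint k′ l′ p ⊎ Endpoint a b p
    x-endpoint p end with endpoint? k′ l′ p | endpoint? a b p | endpoint≥1 vI end
    ... | yes endJ | _ | _ = inj₁ endJ
    ... | no _ | yes endK | _ = inj₂ endK
    x-endpoint (suc q) end | no ¬endJ | no ¬endK | _ = ⊥-elim (coord-jump x x≢ε (proj₁ (proj₂ vI)) end
      (⁻¹-injective (∙-cancelˡ (coord y k′ l′ (suc q)) _ _
        (trans (cong (_// coord x k l q) (sym (coord-flat y ¬endJ))) (D-flat q (endpoint≤ vI end) ¬endK)))))

    y-endpoint : ∀ p → Endpoint k′ l′ p → Endpoint k l p ⊎ Endpoint a b p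
    y-endpoint p end with endpoint? k l p | endpoint? a b p | endpoint≥1 vJ end
    ... | yes endI | _ | _ = inj₁ endI
    ... | no _ | yes endK | _ = inj₂ endK
    y-endpoint (suc q) end | no ¬endI | no ¬endK | _ = ⊥-elim (coord-jump y y≢ε (proj₁ (proj₂ vJ)) end
      (∙-cancelʳ (coord x k l (suc q) ⁻¹) _ _
        (trans (cong (λ c → coord y k′ l′ q // c) (sym (coord-flat x ¬endI))) (D-flat q (endpoint≤ vJ end) ¬endK))))

    private
      k<l = proj₁ (proj₂ vI)
      k′<l′ = proj₁ (proj₂ vJ)
      a<b = proj₁ (proj₂ vK)

    D-inside : ∀ {j} → a ≤ j → j < b → D j ≡ z
    D-inside a≤j j<b = trans (D≡z _ (<⇒≤ (<-≤-trans j<b (proj₂ (proj₂ vK))))) (coord-inside z a≤j j<b)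

    D-below : ∀ {j} → j < a → D j ≡ ε
    D-below j<a = trans (D≡z _ (<⇒≤ (<-≤-trans (<-trans j<a a<b) (proj₂ (proj₂ vK))))) (coord-below z j<a)

    D-above : ∀ {j} → b ≤ j → j ≤ suc m → D j ≡ ε
    D-above b≤j j≤ = trans (D≡z _ j≤) (coord-above z b≤j)

    D≡y//x : ∀ {j} → k′ ≤ j → j < l′ → k ≤ j → j < l → D j ≡ y // x
    D≡y//x k′≤j j<l′ k≤j j<l = cong₂ _//_ (coord-inside y k′≤j j<l′) (coord-inside x k≤j j<l)

    same-interval-labels : k ≡ k′ → l ≡ l′ → x ≢ y
    same-interval-labels refl refl refl = z≢ε (begin
      z                ≡⟨ sym (D-inside ≤-refl a<b) ⟩
      D a              ≡⟨ inverseʳ (coord x k l a) ⟩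
      ε                ∎)
      where open ≡-Reasoning

    same-start-labels : k ≡ k′ → l ≢ l′ → y ≡ x
    same-start-labels refl l≢l′ = x∙y⁻¹≈ε⇒x≈y y x (trans (sym (D≡y//x ≤-refl k′<l′ ≤-refl k<l)) (D-below k<a))
      where
        l∈K = other-endpoint (λ l≡k → <-irrefl (sym l≡k) k<l) l≢l′ (x-endpoint l (inj₂ refl))
        l′∈K = other-endpoint (λ l′≡k → <-irrefl (sym l′≡k) k′<l′) (λ l′≡l → l≢l′ (sym l′≡l)) (y-endpoint l′ (inj₂ refl))
        k<a : k < a
        k<a with l∈K | l′∈K
        ... | inj₁ refl | _ = k<l
        ... | inj₂ _ | inj₁ refl = k′<l′
        ... | inj₂ refl | inj₂ refl = ⊥-elim (l≢l′ refl)

    same-end-labels : l ≡ l′ → k ≢ k′ → y ≡ x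
    same-end-labels refl k≢k′ =
      x∙y⁻¹≈ε⇒x≈y y x (trans (sym (D≡y//x (<⇒≤pred k′<l′) (<⇒pred< k<l) (<⇒≤pred k<l) (<⇒pred< k<l)))
                              (D-above (<⇒≤pred b<l) (≤-trans pred[n]≤n (proj₂ (proj₂ vI)))))
      where
        k∈K = other-endpoint k≢k′ (λ k≡l → <-irrefl k≡l k<l) (x-endpoint k (inj₁ refl))
        k′∈K = other-endpoint (λ k′≡k → k≢k′ (sym k′≡k)) (λ k′≡l → <-irrefl k′≡l k′<l′) (y-endpoint k′ (inj₁ refl))
        b<l : b < l
        b<l with k∈K | k′∈K
        ... | inj₂ refl | _ = k<l
        ... | inj₁ _ | inj₂ refl = k′<l′
        ... | inj₁ refl | inj₁ refl = ⊥-elim (k≢k′ refl)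

    abut-right-labels : l ≡ k′ → y ≡ x ⁻¹
    abut-right-labels refl = begin
      y            ≡⟨ sym (x//ε y) ⟩
      y // ε       ≡⟨ sym (cong₂ _//_ (coord-inside y ≤-refl k′<l′) (coord-above x ≤-refl)) ⟩
      D l          ≡⟨ D-inside (subst (_≤ l) (sym a≡k) (<⇒≤ k<l)) (subst (l <_) l′≡b k′<l′) ⟩
      z            ≡⟨ sym (D-inside (≤-reflexive a≡k) (subst (_< b) a≡k a<b)) ⟩
      D k          ≡⟨ cong₂ _//_ (coord-below y k<l) (coord-inside x ≤-refl k<l) ⟩
      ε // x       ≡⟨ ε//x x ⟩
      x ⁻¹         ∎
      where
        open ≡-Reasoning
        k<l′ = <-trans k<l k′<l′
        k∈K = other-endpoint (λ k≡l → <-irrefl k≡l k<l) (λ k≡l′ → <-irrefl k≡l′ k<l′) (x-endpoint k (inj₁ refl))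
        l′∈K = other-endpoint (λ l′≡k → <-irrefl (sym l′≡k) k<l′) (λ l′≡l → <-irrefl (sym l′≡l) k′<l′) (y-endpoint l′ (inj₂ refl))
        a≡k = sym (proj₁ (endpoints-ordered a<b k∈K l′∈K k<l′))
        l′≡b = proj₂ (endpoints-ordered a<b k∈K l′∈K k<l′)

    abut-left-labels : l′ ≡ k → y ≡ x ⁻¹
    abut-left-labels refl = begin
      y            ≡⟨ sym (x//ε y) ⟩
      y // ε       ≡⟨ sym (cong₂ _//_ (coord-inside y ≤-refl k′<l′) (coord-below x k′<l′)) ⟩
      D k′         ≡⟨ D-inside (≤-reflexive a≡k′) (subst (k′ <_) l≡b k′<l) ⟩
      z            ≡⟨ sym (D-inside (subst (_≤ l′) (sym a≡k′) (<⇒≤ k′<l′)) (subst (l′ <_) l≡b k<l)) ⟩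
      D l′         ≡⟨ cong₂ _//_ (coord-above y ≤-refl) (coord-inside x ≤-refl k<l) ⟩
      ε // x       ≡⟨ ε//x x ⟩
      x ⁻¹         ∎
      where
        open ≡-Reasoning
        k′<l = <-trans k′<l′ k<l
        k′∈K = other-endpoint (λ k′≡l′ → <-irrefl k′≡l′ k′<l′) (λ k′≡l → <-irrefl k′≡l k′<l) (y-endpoint k′ (inj₁ refl))
        l∈K = other-endpoint (λ l≡k′ → <-irrefl (sym l≡k′) k′<l) (λ l≡l′ → <-irrefl (sym l≡l′) k<l) (x-endpoint l (inj₂ refl))
        a≡k′ = sym (proj₁ (endpoints-ordered a<b k′∈K l∈K k′<l))
        l≡b = proj₂ (endpoints-ordered a<b k′∈K l∈K k′<l)

    endpoints-disjoint-impossible : k ≢ k′ → l ≢ l′ → l ≢ k′ → l′ ≢ k → ⊥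
    endpoints-disjoint-impossible k≢k′ l≢l′ l≢k′ l′≢k
      with other-endpoint k≢k′ (λ k≡l′ → l′≢k (sym k≡l′)) (x-endpoint k (inj₁ refl))
         | other-endpoint l≢k′ l≢l′ (x-endpoint l (inj₂ refl))
         | y-endpoint k′ (inj₁ refl)
    ... | k∈K | l∈K | k′∈I⊎K with endpoints-ordered a<b k∈K l∈K k<l
    ...   | refl , refl with k′∈I⊎K
    ...     | inj₁ (inj₁ k′≡k) = k≢k′ (sym k′≡k)
    ...     | inj₁ (inj₂ k′≡l) = l≢k′ (sym k′≡l)
    ...     | inj₂ (inj₁ k′≡k) = k≢k′ (sym k′≡k)
    ...     | inj₂ (inj₂ k′≡l) = l≢k′ (sym k′≡l)

    configuration : Configuration x k l y k′ l′
    configuration with k ≟ k′ | l ≟ l′ | l ≟ k′ | l′ ≟ k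
    ... | yes k≡k′ | yes l≡l′ | _ | _ = same-interval k≡k′ l≡l′ (same-interval-labels k≡k′ l≡l′)
    ... | yes k≡k′ | no l≢l′ | _ | _ = same-start k≡k′ l≢l′ (same-start-labels k≡k′ l≢l′)
    ... | no k≢k′ | yes l≡l′ | _ | _ = same-end l≡l′ k≢k′ (same-end-labels l≡l′ k≢k′)
    ... | no _ | no _ | yes l≡k′ | _ = abut-right l≡k′ (abut-right-labels l≡k′)
    ... | no _ | no _ | no _ | yes l′≡k = abut-left l′≡k (abut-left-labels l′≡k)
    ... | no k≢k′ | no l≢l′ | no l≢k′ | no l′≢k = ⊥-elim (endpoints-disjoint-impossible k≢k′ l≢l′ l≢k′ l′≢k)

  adjacent⇒configuration : ∀ x k l y k′ l′ → ValidInterval k l → ValidInterval k′ l′ → x ≢ ε → y ≢ ε →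
    Adj (ivec x k l) (ivec y k′ l′) → Configuration x k l y k′ l′
  adjacent⇒configuration x k l y k′ l′ vI vJ x≢ε y≢ε (a , b , vK , z , z≢ε , eq) =
    Forward.configuration x y z k l k′ l′ a b vI vJ vK x≢ε y≢ε z≢ε eq

module IntervalGraph {n : ℕ} (G : FinGroup n) (m : ℕ) where
  open IntervalVectors G m public
  open import Algebra.Properties.Group group using (⁻¹-anti-homo-∙)

  Interval : Set
  Interval = ℕ × ℕ

  Valid : Interval → Set
  Valid (k , l) = ValidInterval k l

  vec : C → Interval → Vtx
  vec x (k , l) = ivec x k l

  IsEndpoint : Interval → ℕ → Set
  IsEndpoint (k , l) = Endpoint k l

  isEndpoint? : ∀ I p → Dec (IsEndpoint I p)
  isEndpoint? (k , l) = endpoint? k l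

  Aligned : Interval → Interval → Set
  Aligned (k , l) (k′ , l′) = k ≡ k′ ⊎ l ≡ l′

  aligned? : ∀ I J → Dec (Aligned I J)
  aligned? (k , l) (k′ , l′) = (k ≟ k′) ⊎-dec (l ≟ l′)

  -- The label of the vertex on J adjacent to x_I when I and J touch: x if they share
  -- their start or their end, x⁻¹ if one starts where the other ends.
  opaque
    transport : C → Interval → Interval → C
    transport x I J = if ⌊ aligned? I J ⌋ then x else x ⁻¹

    transport-aligned : ∀ x {I J} → Aligned I J → transport x I J ≡ x
    transport-aligned x {I} {J} aligned with aligned? I J
    ... | yes _ = refl
    ... | no ¬aligned = ⊥-elim (¬aligned aligned)

    transport-unaligned : ∀ x {I J} → ¬ Aligned I J → transport x I J ≡ x ⁻¹
    transport-unaligned x {I} {J} ¬aligned with aligned? I J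
    ... | yes aligned = ⊥-elim (¬aligned aligned)
    ... | no _ = refl

    transport-injective : ∀ x x′ I J → transport x I J ≡ transport x′ I J → x ≡ x′
    transport-injective x x′ I J eq with aligned? I J
    ... | yes _ = eq
    ... | no _ = ⁻¹-injective eq

    transport≢ε : ∀ {x} I J → x ≢ ε → transport x I J ≢ ε
    transport≢ε I J x≢ε with aligned? I J
    ... | yes _ = x≢ε
    ... | no _ = ⁻¹≢ε x≢ε

    transport-⁻¹ : ∀ x I J → transport (x ⁻¹) I J ≡ transport x I J ⁻¹
    transport-⁻¹ x I J with aligned? I J
    ... | yes _ = refl
    ... | no _ = refl

  Touching : Interval → Interval → Set
  Touching I J = (∃[ p ] IsEndpoint I p × IsEndpoint J p) × I ≢ J

  Linked : C → Interval → C → Interval → Set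
  Linked x I y J = (I ≡ J × x ≢ y) ⊎ (Touching I J × y ≡ transport x I J)

  transport-refl : ∀ x I → transport x I I ≡ x
  transport-refl x I = transport-aligned x (inj₁ refl)

  aligned-sym : ∀ {I J} → Aligned I J → Aligned J I
  aligned-sym (inj₁ e) = inj₁ (sym e)
  aligned-sym (inj₂ e) = inj₂ (sym e)

  transport-involutive : ∀ x I J → transport (transport x I J) J I ≡ x
  transport-involutive x I J with aligned? I J
  ... | yes aligned = trans (transport-aligned _ (aligned-sym aligned)) (transport-aligned x aligned)
  ... | no ¬aligned = begin
    transport (transport x I J) J I  ≡⟨ cong (λ y → transport y J I) (transport-unaligned x ¬aligned) ⟩
    transport (x ⁻¹) J I             ≡⟨ transport-unaligned (x ⁻¹) (¬aligned ∘′ aligned-sym) ⟩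
    (x ⁻¹) ⁻¹                        ≡⟨ ⁻¹-involutive x ⟩
    x                                ∎
    where open ≡-Reasoning

  touching-sym : ∀ {I J} → Touching I J → Touching J I
  touching-sym ((p , p∈I , p∈J) , I≢J) = (p , p∈J , p∈I) , (λ J≡I → I≢J (sym J≡I))

  configuration⇒linked : ∀ {x k l y k′ l′} → ValidInterval k l → ValidInterval k′ l′ →
    Configuration x k l y k′ l′ → Linked x (k , l) y (k′ , l′)
  configuration⇒linked _ _ (same-interval refl refl x≢y) = inj₁ (refl , x≢y)
  configuration⇒linked {x} {k} _ _ (same-start k≡k′ l≢l′ refl) =
    inj₂ (((k , inj₁ refl , inj₁ k≡k′) , λ I≡J → l≢l′ (cong proj₂ I≡J)) , sym (transport-aligned x (inj₁ k≡k′)))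
  configuration⇒linked {x} {l = l} _ _ (same-end l≡l′ k≢k′ refl) =
    inj₂ (((l , inj₂ refl , inj₂ l≡l′) , λ I≡J → k≢k′ (cong proj₁ I≡J)) , sym (transport-aligned x (inj₂ l≡l′)))
  configuration⇒linked {x} {l = l} (_ , k<l , _) (_ , k′<l′ , _) (abut-right refl refl) =
    inj₂ (((l , inj₂ refl , inj₁ refl) , λ I≡J → <-irrefl (cong proj₁ I≡J) k<l) , sym (transport-unaligned x unaligned))
    where
      unaligned : ¬ Aligned _ _
      unaligned (inj₁ k≡l) = <-irrefl k≡l k<l
      unaligned (inj₂ l≡l′) = <-irrefl l≡l′ k′<l′
  configuration⇒linked {x} {k} (_ , k<l , _) (_ , k′<l′ , _) (abut-left refl refl) =
    inj₂ (((k , inj₁ refl , inj₂ refl) , λ I≡J → <-irrefl (sym (cong proj₁ I≡J)) k′<l′) , sym (transport-unaligned x unaligned))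
    where
      unaligned : ¬ Aligned _ _
      unaligned (inj₁ k≡k′) = <-irrefl (sym k≡k′) k′<l′
      unaligned (inj₂ l≡k) = <-irrefl (sym l≡k) k<l

  linked⇒configuration : ∀ {x k l y k′ l′} → ValidInterval k l → ValidInterval k′ l′ →
    Linked x (k , l) y (k′ , l′) → Configuration x k l y k′ l′
  linked⇒configuration _ _ (inj₁ (refl , x≢y)) = same-interval refl refl x≢y
  linked⇒configuration {x} {k} {l} {y} {k′} {l′} (_ , k<l , _) (_ , k′<l′ , _) (inj₂ (((p , p∈I , p∈J) , I≢J) , refl)) =
    by-endpoint p∈I p∈J
    where
      by-endpoint : Endpoint k l p → Endpoint k′ l′ p → Configuration x k l (transport x (k , l) (k′ , l′)) k′ l′
      by-endpoint (inj₁ refl) (inj₁ k≡k′) =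
        same-start k≡k′ (λ l≡l′ → I≢J (cong₂ _,_ k≡k′ l≡l′)) (transport-aligned x (inj₁ k≡k′))
      by-endpoint (inj₂ refl) (inj₂ l≡l′) =
        same-end l≡l′ (λ k≡k′ → I≢J (cong₂ _,_ k≡k′ l≡l′)) (transport-aligned x (inj₂ l≡l′))
      by-endpoint (inj₂ refl) (inj₁ l≡k′) = abut-right l≡k′ (transport-unaligned x unaligned)
        where
          unaligned : ¬ Aligned (k , l) (k′ , l′)
          unaligned (inj₁ k≡k′) = <-irrefl (trans k≡k′ (sym l≡k′)) k<l
          unaligned (inj₂ l≡l′) = <-irrefl (trans (sym l≡k′) l≡l′) k′<l′
      by-endpoint (inj₁ refl) (inj₂ k≡l′) = abut-left (sym k≡l′) (transport-unaligned x unaligned)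
        where
          unaligned : ¬ Aligned (k , l) (k′ , l′)
          unaligned (inj₁ k≡k′) = <-irrefl (trans (sym k≡k′) k≡l′) k′<l′
          unaligned (inj₂ l≡l′) = <-irrefl (trans k≡l′ (sym l≡l′)) k<l

  adjacent⇒linked : ∀ {x I y J} → Valid I → Valid J → x ≢ ε → y ≢ ε → Adj (vec x I) (vec y J) → Linked x I y J
  adjacent⇒linked {x} {k , l} {y} {k′ , l′} vI vJ x≢ε y≢ε adj =
    configuration⇒linked vI vJ (adjacent⇒configuration x k l y k′ l′ vI vJ x≢ε y≢ε adj)

  linked⇒adjacent : ∀ {x I y J} → Valid I → Valid J → x ≢ ε → Linked x I y J → Adj (vec x I) (vec y J)
  linked⇒adjacent {x} {k , l} {y} {k′ , l′} vI vJ x≢ε linked =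
    configuration⇒adjacent x k l y k′ l′ vI vJ x≢ε (linked⇒configuration vI vJ linked)

  vec-injective : ∀ {x y I J} → Valid I → Valid J → x ≢ ε → vec x I ≡ vec y J → x ≡ y × I ≡ J
  vec-injective {x} {y} {k , l} {k′ , l′} vI@(1≤k , k<l , l≤) vJ@(1≤k′ , k′<l′ , l′≤) x≢ε eq =
    x≡y , cong₂ _,_ (proj₁ k,l≡k′,l′) (proj₂ k,l≡k′,l′)
    where
      agree : ∀ j → j ≤ suc m → coord x k l j ≡ coord y k′ l′ j
      agree = tabulate-suc-agree m _ _ (trans (sym (ivec≡tabulate-coord x k l)) (trans eq (ivec≡tabulate-coord y k′ l′)))
        (trans (coord-below x 1≤k) (sym (coord-below y 1≤k′)))
        (trans (coord-above x l≤) (sym (coord-above y l′≤)))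
      endpoint-of-J : ∀ p → Endpoint k l p → Endpoint k′ l′ p
      endpoint-of-J p end with endpoint? k′ l′ p | endpoint≥1 vI end
      ... | yes endJ | _ = endJ
      endpoint-of-J (suc q) end | no ¬endJ | _ = ⊥-elim (coord-jump x x≢ε k<l end
        (trans (agree q (≤-trans (n≤1+n q) (endpoint≤ vI end)))
          (trans (coord-flat y ¬endJ) (sym (agree (suc q) (endpoint≤ vI end))))))
      k,l≡k′,l′ = endpoints-ordered k′<l′ (endpoint-of-J k (inj₁ refl)) (endpoint-of-J l (inj₂ refl)) k<l
      k′≡k = sym (proj₁ k,l≡k′,l′)
      x≡y : x ≡ y
      x≡y = begin
        x              ≡⟨ sym (coord-inside x ≤-refl k<l) ⟩
        coord x k l k  ≡⟨ agree k (≤-trans (<⇒≤ k<l) l≤) ⟩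
        coord y k′ l′ k ≡⟨ coord-inside y (≤-reflexive k′≡k) (subst (_< l′) k′≡k k′<l′) ⟩
        y              ∎
        where open ≡-Reasoning

  vec≢𝐞 : ∀ {x I} → Valid I → x ≢ ε → vec x I ≢ 𝐞
  vec≢𝐞 {x} {suc q , l} (_ , k<l , l≤) x≢ε eq = x≢ε (begin
    x                          ≡⟨ sym (coord-inside x ≤-refl k<l) ⟩
    coord x (suc q) l (suc q)  ≡⟨ cong (coord x (suc q) l ∘′ suc) (sym (toℕ-fromℕ< q<m)) ⟩
    coord x (suc q) l (suc (toℕ i)) ≡⟨ sym (lookup∘tabulate _ i) ⟩
    lookup (tabulate (λ j → coord x (suc q) l (suc (toℕ j)))) i ≡⟨ cong (λ v → lookup v i) (sym (ivec≡tabulate-coord x (suc q) l)) ⟩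
    lookup (ivec x (suc q) l) i ≡⟨ cong (λ v → lookup v i) eq ⟩
    lookup 𝐞 i                 ≡⟨ lookup-replicate i ε ⟩
    ε                          ∎)
    where
      open ≡-Reasoning
      q<m : q < m
      q<m = ≤-pred (≤-trans k<l l≤)
      i = fromℕ< q<m

  //-swap : ∀ a b → a // b ≡ (b // a) ⁻¹
  //-swap a b = sym (begin
    (b // a) ⁻¹            ≡⟨ ⁻¹-anti-homo-∙ b (a ⁻¹) ⟩
    ((a ⁻¹) ⁻¹) ∙ (b ⁻¹)   ≡⟨ cong (_∙ (b ⁻¹)) (⁻¹-involutive a) ⟩
    a // b                 ∎)
    where open ≡-Reasoning

  zipWith-//-swap : ∀ {k} (g h : Vec C k) → zipWith _//_ g h ≡ Vec.map _⁻¹ (zipWith _//_ h g)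
  zipWith-//-swap [] [] = refl
  zipWith-//-swap (a ∷ g) (b ∷ h) = cong₂ _∷_ (//-swap a b) (zipWith-//-swap g h)

  InS-⁻¹ : ∀ {v} → InS v → InS (Vec.map _⁻¹ v)
  InS-⁻¹ (k , l , valid , x , x≢ε , refl) = k , l , valid , x ⁻¹ , ⁻¹≢ε x≢ε , (begin
    Vec.map _⁻¹ (ivec x k l)                                  ≡⟨ cong (Vec.map _⁻¹) (ivec≡tabulate-coord x k l) ⟩
    Vec.map _⁻¹ (tabulate (λ i → coord x k l (suc (toℕ i))))  ≡⟨ sym (tabulate-∘ _⁻¹ _) ⟩
    tabulate (λ i → coord x k l (suc (toℕ i)) ⁻¹)         ≡⟨ tabulate-cong (λ i → coord-⁻¹ x k l (suc (toℕ i))) ⟩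
    tabulate (λ i → coord (x ⁻¹) k l (suc (toℕ i)))       ≡⟨ sym (ivec≡tabulate-coord (x ⁻¹) k l) ⟩
    ivec (x ⁻¹) k l                                       ∎)
    where open ≡-Reasoning

  adjacent-sym : ∀ {g h} → Adj g h → Adj h g
  adjacent-sym {g} {h} adj = subst InS (sym (zipWith-//-swap g h)) (InS-⁻¹ adj)

  zipWith-//-𝐞 : ∀ w → zipWith _//_ w 𝐞 ≡ w
  zipWith-//-𝐞 w = trans (zipWith-replicate₂ _//_ w ε) (trans (map-cong x//ε w) (map-id w))

  𝐞-adjacent⁺ : ∀ {w} → InS w → Adj 𝐞 w
  𝐞-adjacent⁺ {w} = subst InS (sym (zipWith-//-𝐞 w))

  𝐞-adjacent⁻ : ∀ {w} → Adj 𝐞 w → InS w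
  𝐞-adjacent⁻ {w} = subst InS (zipWith-//-𝐞 w)

  vec∈S : ∀ {x I} → Valid I → x ≢ ε → InS (vec x I)
  vec∈S {x} {k , l} valid x≢ε = k , l , valid , x , x≢ε , refl

  -- Valid intervals are the edges {p, q} of the complete graph on {1, …, m + 1}.
  edge : ℕ → ℕ → Interval
  edge p q = p ⊓ q , p ⊔ q

  edge-< : ∀ {p q} → p < q → edge p q ≡ (p , q)
  edge-< p<q = cong₂ _,_ (m≤n⇒m⊓n≡m (<⇒≤ p<q)) (m≤n⇒m⊔n≡n (<⇒≤ p<q))

  edge-> : ∀ {p q} → q < p → edge p q ≡ (q , p)
  edge-> q<p = cong₂ _,_ (m≥n⇒m⊓n≡n (<⇒≤ q<p)) (m≥n⇒m⊔n≡m (<⇒≤ q<p))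

  edge-comm : ∀ p q → edge p q ≡ edge q p
  edge-comm p q = cong₂ _,_ (⊓-comm p q) (⊔-comm p q)

  InRange : ℕ → Set
  InRange p = 1 ≤ p × p ≤ suc m

  edge-valid : ∀ {p q} → InRange p → InRange q → p ≢ q → Valid (edge p q)
  edge-valid {p} {q} (1≤p , p≤) (1≤q , q≤) p≢q with <-cmp p q
  ... | tri< p<q _ _ = subst Valid (sym (edge-< p<q)) (1≤p , p<q , q≤)
  ... | tri≈ _ p≡q _ = ⊥-elim (p≢q p≡q)
  ... | tri> _ _ q<p = subst Valid (sym (edge-> q<p)) (1≤q , q<p , p≤)

  edge-endpointˡ : ∀ p q → IsEndpoint (edge p q) p
  edge-endpointˡ p q with <-cmp p q
  ... | tri< p<q _ _ = subst (λ K → IsEndpoint K p) (sym (edge-< p<q)) (inj₁ refl)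
  ... | tri≈ _ refl _ = inj₁ (sym (⊓-idem p))
  ... | tri> _ _ q<p = subst (λ K → IsEndpoint K p) (sym (edge-> q<p)) (inj₂ refl)

  edge-endpointʳ : ∀ p q → IsEndpoint (edge p q) q
  edge-endpointʳ p q = subst (λ K → IsEndpoint K q) (edge-comm q p) (edge-endpointˡ q p)

  edge-endpoint⁻ : ∀ {p q r} → IsEndpoint (edge p q) r → r ≡ p ⊎ r ≡ q
  edge-endpoint⁻ {p} {q} {r} end with <-cmp p q
  ... | tri< p<q _ _ = subst (λ K → IsEndpoint K r) (edge-< p<q) end
  ... | tri≈ _ refl _ = inj₁ ([ (λ r≡p⊓p → trans r≡p⊓p (⊓-idem p)) , (λ r≡p⊔p → trans r≡p⊔p (⊔-idem p)) ]′ end)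
  ... | tri> _ _ q<p = swap (subst (λ K → IsEndpoint K r) (edge-> q<p) end)

  endpoint-inRange : ∀ {K p} → Valid K → IsEndpoint K p → InRange p
  endpoint-inRange valid end = endpoint≥1 valid end , endpoint≤ valid end

  as-edge : ∀ {K p} → Valid K → IsEndpoint K p → ∃[ t ] t ≢ p × InRange t × K ≡ edge p t
  as-edge (1≤k , k<l , l≤) (inj₁ refl) = _ , (λ l≡k → <-irrefl (sym l≡k) k<l) , (≤-trans 1≤k (<⇒≤ k<l) , l≤) , sym (edge-< k<l)
  as-edge (1≤k , k<l , l≤) (inj₂ refl) = _ , (λ k≡l → <-irrefl k≡l k<l) , (1≤k , ≤-trans (<⇒≤ k<l) l≤) , sym (edge-> k<l)

  edge-unique : ∀ {K p q} → Valid K → IsEndpoint K p → IsEndpoint K q → p ≢ q → K ≡ edge p q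
  edge-unique valid p∈K q∈K p≢q with as-edge valid p∈K
  ... | t , t≢p , _ , refl with edge-endpoint⁻ q∈K
  ...   | inj₁ q≡p = ⊥-elim (p≢q (sym q≡p))
  ...   | inj₂ refl = refl

  edge-injectiveʳ : ∀ {p t t′} → t ≢ p → edge p t ≡ edge p t′ → t ≡ t′
  edge-injectiveʳ {p} {t} t≢p eq with edge-endpoint⁻ (subst (λ K → IsEndpoint K t) eq (edge-endpointʳ p t))
  ... | inj₁ t≡p = ⊥-elim (t≢p t≡p)
  ... | inj₂ t≡t′ = t≡t′

  side : ℕ → ℕ → Bool
  side p q = ⌊ p <? q ⌋

  side-flip : ∀ {p q} → p ≢ q → side q p ≡ not (side p q)
  side-flip {p} {q} p≢q with p <? q | q <? p
  ... | yes p<q | yes q<p = ⊥-elim (<-asym p<q q<p)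
  ... | yes _ | no _ = refl
  ... | no _ | yes _ = refl
  ... | no p≮q | no q≮p = ⊥-elim (p≢q (≤-antisym (≮⇒≥ q≮p) (≮⇒≥ p≮q)))

  invertIf : Bool → C → C
  invertIf b x = if b then x ⁻¹ else x

  invertIf-xor : ∀ b c x → invertIf b (invertIf c x) ≡ invertIf (b xor c) x
  invertIf-xor false c x = refl
  invertIf-xor true false x = refl
  invertIf-xor true true x = ⁻¹-involutive x

  transport-at : ∀ x {p q r} → p ≢ q → p ≢ r → transport x (edge p q) (edge p r) ≡ invertIf (side p q xor side p r) x
  transport-at x {p} {q} {r} p≢q p≢r with p <? q | p <? r
  ... | yes p<q | yes p<r = trans (cong₂ (transport x) (edge-< p<q) (edge-< p<r)) (transport-aligned x (inj₁ refl))
  ... | yes p<q | no p≮r = trans (cong₂ (transport x) (edge-< p<q) (edge-> r<p)) (transport-unaligned x unaligned)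
    where
      r<p = ≤∧≢⇒< (≮⇒≥ p≮r) (p≢r ∘′ sym)
      unaligned : ¬ Aligned (p , q) (r , p)
      unaligned (inj₁ p≡r) = <-irrefl (sym p≡r) r<p
      unaligned (inj₂ q≡p) = <-irrefl (sym q≡p) p<q
  ... | no p≮q | yes p<r = trans (cong₂ (transport x) (edge-> q<p) (edge-< p<r)) (transport-unaligned x unaligned)
    where
      q<p = ≤∧≢⇒< (≮⇒≥ p≮q) (p≢q ∘′ sym)
      unaligned : ¬ Aligned (q , p) (p , r)
      unaligned (inj₁ q≡p) = <-irrefl q≡p q<p
      unaligned (inj₂ p≡r) = <-irrefl p≡r p<r
  ... | no p≮q | no p≮r =
    trans (cong₂ (transport x) (edge-> (≤∧≢⇒< (≮⇒≥ p≮q) (p≢q ∘′ sym))) (edge-> (≤∧≢⇒< (≮⇒≥ p≮r) (p≢r ∘′ sym))))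
          (transport-aligned x (inj₂ refl))

  xor-cancel-middle : ∀ a b c → (b xor c) xor (a xor b) ≡ a xor c
  xor-cancel-middle a b c = begin
    (b xor c) xor (a xor b)   ≡⟨ xor-comm (b xor c) (a xor b) ⟩
    (a xor b) xor (b xor c)   ≡⟨ xor-assoc a b (b xor c) ⟩
    a xor (b xor (b xor c))   ≡⟨ cong (a xor_) (sym (xor-assoc b b c)) ⟩
    a xor ((b xor b) xor c)   ≡⟨ cong (λ d → a xor (d xor c)) (xor-same b) ⟩
    a xor c                   ∎
    where open ≡-Reasoning

  transport-trans : ∀ x {p q r t} → p ≢ q → p ≢ r → p ≢ t →
    transport (transport x (edge p q) (edge p r)) (edge p r) (edge p t) ≡ transport x (edge p q) (edge p t)
  transport-trans x {p} {q} {r} {t} p≢q p≢r p≢t = begin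
    transport (transport x (edge p q) (edge p r)) (edge p r) (edge p t)
      ≡⟨ transport-at _ p≢r p≢t ⟩
    invertIf (side p r xor side p t) (transport x (edge p q) (edge p r))
      ≡⟨ cong (invertIf (side p r xor side p t)) (transport-at x p≢q p≢r) ⟩
    invertIf (side p r xor side p t) (invertIf (side p q xor side p r) x)
      ≡⟨ invertIf-xor (side p r xor side p t) (side p q xor side p r) x ⟩
    invertIf ((side p r xor side p t) xor (side p q xor side p r)) x
      ≡⟨ cong (λ b → invertIf b x) (xor-cancel-middle (side p q) (side p r) (side p t)) ⟩
    invertIf (side p q xor side p t) x
      ≡⟨ sym (transport-at x p≢q p≢t) ⟩
    transport x (edge p q) (edge p t) ∎
    where open ≡-Reasoning

  transport-triangle : ∀ x {p q r} → p ≢ q → p ≢ r → q ≢ r →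
    transport (transport x (edge p q) (edge p r)) (edge p r) (edge q r) ≡ transport x (edge p q) (edge q r) ⁻¹
  transport-triangle x {p} {q} {r} p≢q p≢r q≢r = begin
    transport (transport x (edge p q) (edge p r)) (edge p r) (edge q r)
      ≡⟨ cong₂ (transport _) (edge-comm p r) (edge-comm q r) ⟩
    transport (transport x (edge p q) (edge p r)) (edge r p) (edge r q)
      ≡⟨ transport-at _ (p≢r ∘′ sym) (q≢r ∘′ sym) ⟩
    invertIf (side r p xor side r q) (transport x (edge p q) (edge p r))
      ≡⟨ cong (invertIf (side r p xor side r q)) (transport-at x p≢q p≢r) ⟩
    invertIf (side r p xor side r q) (invertIf (side p q xor side p r) x)
      ≡⟨ invertIf-xor (side r p xor side r q) (side p q xor side p r) x ⟩
    invertIf ((side r p xor side r q) xor (side p q xor side p r)) x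
      ≡⟨ cong (λ b → invertIf b x) signs ⟩
    invertIf (true xor (side q p xor side q r)) x
      ≡⟨ sym (invertIf-xor true (side q p xor side q r) x) ⟩
    invertIf (side q p xor side q r) x ⁻¹
      ≡⟨ cong (_⁻¹) (sym (transport-at x (p≢q ∘′ sym) q≢r)) ⟩
    transport x (edge q p) (edge q r) ⁻¹
      ≡⟨ cong (λ K → transport x K (edge q r) ⁻¹) (edge-comm q p) ⟩
    transport x (edge p q) (edge q r) ⁻¹ ∎
    where
      open ≡-Reasoning
      a = side p q
      b = side p r
      c = side q r
      signs : (side r p xor side r q) xor (a xor b) ≡ true xor (side q p xor side q r)
      signs = begin
        (side r p xor side r q) xor (a xor b)  ≡⟨ cong₂ (λ u v → (u xor v) xor (a xor b)) (side-flip p≢r) (side-flip q≢r) ⟩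
        (not b xor not c) xor (a xor b)        ≡⟨ cong (_xor (a xor b)) (xor-annihilates-not b c) ⟩
        (b xor c) xor (a xor b)                ≡⟨ xor-cancel-middle a b c ⟩
        a xor c                                ≡⟨ sym (trans (not-distribˡ-xor (not a) c) (cong (_xor c) (not-involutive a))) ⟩
        true xor (not a xor c)                 ≡⟨ cong (λ u → true xor (u xor c)) (sym (side-flip p≢q)) ⟩
        true xor (side q p xor c)              ∎

  touching-edge : ∀ {p q K} → Touching (edge p q) K → IsEndpoint K p ⊎ IsEndpoint K q
  touching-edge ((r , r∈pq , r∈K) , _) with edge-endpoint⁻ r∈pq
  ... | inj₁ refl = inj₁ r∈K
  ... | inj₂ refl = inj₂ r∈K

  touching-edge-other : ∀ {p q K} → Touching (edge p q) K → ¬ IsEndpoint K p → IsEndpoint K q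
  touching-edge-other touch p∉K with touching-edge touch
  ... | inj₁ p∈K = ⊥-elim (p∉K p∈K)
  ... | inj₂ q∈K = q∈K

  edges-touching : ∀ {p q r} → p ≢ q → q ≢ r → Touching (edge p q) (edge p r)
  edges-touching {p} {q} {r} p≢q q≢r = (p , edge-endpointˡ p q , edge-endpointˡ p r) , λ eq → q≢r (edge-injectiveʳ (p≢q ∘′ sym) eq)

  ∉-edge : ∀ {p q r} → p ≢ r → q ≢ r → ¬ IsEndpoint (edge p q) r
  ∉-edge p≢r q≢r r∈pq with edge-endpoint⁻ r∈pq
  ... | inj₁ r≡p = p≢r (sym r≡p)
  ... | inj₂ r≡q = q≢r (sym r≡q)

module CliqueSetting (m : ℕ) (G : FinGroup (suc m)) where
  open IntervalGraph G m public

  _≟ᵥ_ : (u v : Vtx) → Dec (u ≡ v)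
  _≟ᵥ_ = ≡-dec Fin._≟_

  _≟ᵢ_ : (I J : Interval) → Dec (I ≡ J)
  _≟ᵢ_ = ×-≡-dec ℕ._≟_ ℕ._≟_

  module VertexCounting = Counting _≟ᵥ_
  module LabelCounting = Counting (Fin._≟_ {suc m})
  module PointCounting = Counting ℕ._≟_

  open LabelCounting using (remove; ∈-remove⁺; ∈-remove⁻; unique-remove⁺; length-remove)

  nonIdentity : List C
  nonIdentity = remove ε (allFin (suc m))

  length-nonIdentity : length nonIdentity ≡ m
  length-nonIdentity = suc-injective (trans (length-remove ε (allFin (suc m)) (allFin⁺ (suc m)) (∈-allFin ε))
                                            (length-tabulate {n = suc m} (λ i → i)))

  unique-nonIdentity : Unique nonIdentity
  unique-nonIdentity = unique-remove⁺ ε (allFin (suc m)) (allFin⁺ (suc m))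

  ∈-nonIdentity⁺ : ∀ {z} → z ≢ ε → z ∈ nonIdentity
  ∈-nonIdentity⁺ {z} z≢ε = ∈-remove⁺ ε (allFin (suc m)) (∈-allFin z) z≢ε

  ∈-nonIdentity⁻ : ∀ {z} → z ∈ nonIdentity → z ≢ ε
  ∈-nonIdentity⁻ z∈ = proj₂ (∈-remove⁻ ε (allFin (suc m)) z∈)

  points : List ℕ
  points = applyUpTo suc (suc m)

  length-points : length points ≡ suc m
  length-points = length-applyUpTo suc (suc m)

  unique-points : Unique points
  unique-points = applyUpTo⁺₁ suc (suc m) (λ i<j _ 1+i≡1+j → <-irrefl (suc-injective 1+i≡1+j) i<j)

  ∈-points⁺ : ∀ {t} → InRange t → t ∈ points
  ∈-points⁺ {suc t} (_ , s≤s t≤m) = ∈-applyUpTo⁺ suc (s≤s t≤m)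

  ∈-points⁻ : ∀ {t} → t ∈ points → InRange t
  ∈-points⁻ t∈ with ∈-applyUpTo⁻ suc t∈
  ... | _ , i<1+m , refl = s≤s z≤n , i<1+m

  module Clique (Q : List Vtx) (clique : CliqueWithE Q) where

    members-adjacent : ∀ {u w} → u ∈ Q → w ∈ Q → u ≢ w → Adj u w
    members-adjacent u∈Q w∈Q u≢w with allPairs-lookup (proj₂ (proj₂ clique)) u∈Q w∈Q u≢w
    ... | inj₁ adj = adj
    ... | inj₂ adj = adjacent-sym adj

    member∈S : ∀ {w} → InQ* Q w → InS w
    member∈S (w∈Q , w≢𝐞) = 𝐞-adjacent⁻ (members-adjacent (proj₁ (proj₂ clique)) w∈Q (λ 𝐞≡w → w≢𝐞 (sym 𝐞≡w)))

    members-linked : ∀ {x I y J} → Valid I → Valid J → x ≢ ε → y ≢ ε →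
      vec x I ∈ Q → vec y J ∈ Q → vec x I ≢ vec y J → Linked x I y J
    members-linked vI vJ x≢ε y≢ε u∈Q w∈Q u≢w = adjacent⇒linked vI vJ x≢ε y≢ε (members-adjacent u∈Q w∈Q u≢w)

    members : List Vtx
    members = VertexCounting.remove 𝐞 Q

    ∈-members⁻ : ∀ {w} → w ∈ members → InQ* Q w
    ∈-members⁻ = VertexCounting.∈-remove⁻ 𝐞 Q

    ∈-members⁺ : ∀ {w} → InQ* Q w → w ∈ members
    ∈-members⁺ (w∈Q , w≢𝐞) = VertexCounting.∈-remove⁺ 𝐞 Q w∈Q w≢𝐞

    unique-members : Unique members
    unique-members = VertexCounting.unique-remove⁺ 𝐞 Q (proj₁ clique)

    length-members : suc (length members) ≡ length Q
    length-members = VertexCounting.length-remove 𝐞 Q (proj₁ clique) (proj₁ (proj₂ clique))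

    -- Adjacency to x_I forces the labels on the other intervals, and the member y_J
    -- with J ≠ I rules out a second label on I.
    member-transport : ∀ {x I y J z K} → Valid I → Valid J → Valid K → x ≢ ε → y ≢ ε → z ≢ ε → I ≢ J →
      vec x I ∈ Q → vec y J ∈ Q → vec z K ∈ Q → (K ≡ I ⊎ Touching I K) × z ≡ transport x I K
    member-transport {x} {I} {y} {J} {z} {K} vI vJ vK x≢ε y≢ε z≢ε I≢J x∈Q y∈Q z∈Q with K ≟ᵢ I
    ... | no K≢I with members-linked vI vK x≢ε z≢ε x∈Q z∈Q (λ eq → K≢I (sym (proj₂ (vec-injective vI vK x≢ε eq))))
    ...   | inj₁ (I≡K , _) = ⊥-elim (K≢I (sym I≡K))
    ...   | inj₂ (touch , z≡) = inj₂ touch , z≡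
    member-transport {x} {I} {y} {J} {z} {K} vI vJ vK x≢ε y≢ε z≢ε I≢J x∈Q y∈Q z∈Q | yes refl with z Fin.≟ x
    ... | yes refl = inj₁ refl , sym (transport-refl z I)
    ... | no z≢x = ⊥-elim (z≢x (transport-injective z x I J (trans (sym (label-of z≢ε z∈Q)) (label-of x≢ε x∈Q))))
      where
        label-of : ∀ {u} → u ≢ ε → vec u I ∈ Q → y ≡ transport u I J
        label-of u≢ε u∈Q with members-linked vI vJ u≢ε y≢ε u∈Q y∈Q (λ eq → I≢J (proj₂ (vec-injective vI vJ u≢ε eq)))
        ... | inj₁ (I≡J , _) = ⊥-elim (I≢J I≡J)
        ... | inj₂ (_ , y≡) = y≡

  opaque
    neighbourList : C → Interval → List C → List Interval → List Vtx
    neighbourList y J zs Ks = map (λ z → vec z J) zs ++ map (λ K → vec (transport y J K) K) Ks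

    length-neighbourList : ∀ y J zs Ks → length (neighbourList y J zs Ks) ≡ length zs + length Ks
    length-neighbourList y J zs Ks =
      trans (length-++ (map (λ z → vec z J) zs)) (cong₂ _+_ (length-map _ zs) (length-map _ Ks))

    unique-neighbourList : ∀ {y J zs Ks} → y ≢ ε → Valid J → Unique zs → Unique Ks →
      (∀ {z} → z ∈ zs → z ≢ ε) → (∀ {K} → K ∈ Ks → Valid K × K ≢ J) → Unique (neighbourList y J zs Ks)
    unique-neighbourList {y} {J} {zs} {Ks} y≢ε vJ uzs uKs zs≢ε Ks-valid =
      ++⁺ (unique-map⁺ zs uzs (λ z∈ _ eq → proj₁ (vec-injective vJ vJ (zs≢ε z∈) eq)))
          (unique-map⁺ Ks uKs (λ K∈ K′∈ eq →
            proj₂ (vec-injective (proj₁ (Ks-valid K∈)) (proj₁ (Ks-valid K′∈)) (transport≢ε _ _ y≢ε) eq)))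
          disjoint
      where
        disjoint : ∀ {v} → ¬ (v ∈ map (λ z → vec z J) zs × v ∈ map (λ K → vec (transport y J K) K) Ks)
        disjoint (v∈zs , v∈Ks) with ∈-map⁻ _ v∈zs | ∈-map⁻ _ v∈Ks
        ... | z , z∈ , refl | K , K∈ , eq = proj₂ (Ks-valid K∈) (sym (proj₂ (vec-injective vJ (proj₁ (Ks-valid K∈)) (zs≢ε z∈) eq)))

    ∈-neighbourList⁻ : ∀ {y J zs Ks w} → w ∈ neighbourList y J zs Ks →
      (∃[ z ] z ∈ zs × w ≡ vec z J) ⊎ (∃[ K ] K ∈ Ks × w ≡ vec (transport y J K) K)
    ∈-neighbourList⁻ {J = J} {zs} w∈ with ∈-++⁻ (map (λ z → vec z J) zs) w∈
    ... | inj₁ w∈zs = inj₁ (∈-map⁻ _ w∈zs)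
    ... | inj₂ w∈Ks = inj₂ (∈-map⁻ _ w∈Ks)

    ∈-neighbourList⁺ˡ : ∀ {y J zs Ks z} → z ∈ zs → vec z J ∈ neighbourList y J zs Ks
    ∈-neighbourList⁺ˡ z∈ = ∈-++⁺ˡ (∈-map⁺ _ z∈)

    ∈-neighbourList⁺ʳ : ∀ {y J zs Ks K} → K ∈ Ks → vec (transport y J K) K ∈ neighbourList y J zs Ks
    ∈-neighbourList⁺ʳ {J = J} {zs} K∈ = ∈-++⁺ʳ (map (λ z → vec z J) zs) (∈-map⁺ _ K∈)

  neighbourList-adjacent : ∀ {y J zs Ks w} → Valid J → y ≢ ε → (∀ {z} → z ∈ zs → z ≢ y) →
    (∀ {K} → K ∈ Ks → Valid K × Touching J K) → w ∈ neighbourList y J zs Ks → Adj (vec y J) w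
  neighbourList-adjacent {y} {J} {zs} {Ks} vJ y≢ε zs≢y Ks-touch w∈ with ∈-neighbourList⁻ {y} {J} {zs} {Ks} w∈
  ... | inj₁ (z , z∈ , refl) = linked⇒adjacent vJ vJ y≢ε (inj₁ (refl , λ y≡z → zs≢y z∈ (sym y≡z)))
  ... | inj₂ (K , K∈ , refl) = linked⇒adjacent vJ (proj₁ (Ks-touch K∈)) y≢ε (inj₂ (proj₂ (Ks-touch K∈) , refl))

  opaque
    pointsExcept : List ℕ → List ℕ
    pointsExcept ps = PointCounting.removeAll ps points

    ∈-pointsExcept⁻ : ∀ {ps t} → t ∈ pointsExcept ps → InRange t × t ∉ ps
    ∈-pointsExcept⁻ {ps} t∈ with PointCounting.∈-removeAll⁻ ps points t∈
    ... | t∈points , t∉ps = ∈-points⁻ t∈points , t∉ps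

    ∈-pointsExcept⁺ : ∀ {ps t} → InRange t → t ∉ ps → t ∈ pointsExcept ps
    ∈-pointsExcept⁺ {ps} t∈range t∉ps = PointCounting.∈-removeAll⁺ ps points (∈-points⁺ t∈range) t∉ps

    unique-pointsExcept : ∀ ps → Unique (pointsExcept ps)
    unique-pointsExcept ps = PointCounting.unique-removeAll⁺ ps points unique-points

    length-pointsExcept : ∀ {ps} → Unique ps → (∀ {p} → p ∈ ps → InRange p) → length ps + length (pointsExcept ps) ≡ suc m
    length-pointsExcept {ps} ups ps-range =
      trans (PointCounting.length-removeAll ps points ups unique-points (∈-points⁺ ∘′ ps-range)) length-points

    labelsExcept : List C → List C
    labelsExcept zs = LabelCounting.removeAll zs nonIdentity

    ∈-labelsExcept⁻ : ∀ {zs z} → z ∈ labelsExcept zs → z ≢ ε × z ∉ zs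
    ∈-labelsExcept⁻ {zs} z∈ with LabelCounting.∈-removeAll⁻ zs nonIdentity z∈
    ... | z∈nonIdentity , z∉zs = ∈-nonIdentity⁻ z∈nonIdentity , z∉zs

    ∈-labelsExcept⁺ : ∀ {zs z} → z ≢ ε → z ∉ zs → z ∈ labelsExcept zs
    ∈-labelsExcept⁺ {zs} z≢ε z∉zs = LabelCounting.∈-removeAll⁺ zs nonIdentity (∈-nonIdentity⁺ z≢ε) z∉zs

    unique-labelsExcept : ∀ zs → Unique (labelsExcept zs)
    unique-labelsExcept zs = LabelCounting.unique-removeAll⁺ zs nonIdentity unique-nonIdentity

    length-labelsExcept : ∀ {zs} → Unique zs → (∀ {z} → z ∈ zs → z ≢ ε) → length zs + length (labelsExcept zs) ≡ m
    length-labelsExcept {zs} uzs zs≢ε =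
      trans (LabelCounting.length-removeAll zs nonIdentity uzs unique-nonIdentity (∈-nonIdentity⁺ ∘′ zs≢ε)) length-nonIdentity

  ∈-pointsExcept₃⁻ : ∀ {a b c t} → t ∈ pointsExcept (a ∷ b ∷ c ∷ []) → InRange t × t ≢ a × t ≢ b × t ≢ c
  ∈-pointsExcept₃⁻ t∈ with ∈-pointsExcept⁻ t∈
  ... | rt , t∉ = rt , t∉ ∘′ here , t∉ ∘′ there ∘′ here , t∉ ∘′ there ∘′ there ∘′ here

  ∈-pointsExcept₃⁺ : ∀ {a b c t} → InRange t → t ≢ a → t ≢ b → t ≢ c → t ∈ pointsExcept (a ∷ b ∷ c ∷ [])
  ∈-pointsExcept₃⁺ rt t≢a t≢b t≢c =
    ∈-pointsExcept⁺ rt λ { (here t≡a) → t≢a t≡a ; (there (here t≡b)) → t≢b t≡b ; (there (there (here t≡c))) → t≢c t≡c }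

  length-pointsExcept₃ : ∀ {a b c} → InRange a → InRange b → InRange c → a ≢ b → a ≢ c → b ≢ c →
    suc (suc (length (pointsExcept (a ∷ b ∷ c ∷ [])))) ≡ m
  length-pointsExcept₃ ra rb rc a≢b a≢c b≢c = suc-injective (length-pointsExcept ((a≢b ∷ a≢c ∷ []) ∷ (b≢c ∷ []) ∷ [] ∷ [])
    λ { (here refl) → ra ; (there (here refl)) → rb ; (there (there (here refl))) → rc })

twice∸2 : ∀ k → 2 * suc k ∸ 2 ≡ k + k
twice∸2 k = trans (cong (_∸ 1) (+-suc k (k + 0))) (cong (k +_) (+-identityʳ k))

module IntervalCliques (m : ℕ) (G : FinGroup (suc m)) where
  open CliqueSetting m G

  fullIntervalClique : Interval → List Vtx
  fullIntervalClique I = 𝐞 ∷ map (λ x → vec x I) nonIdentity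

  fullIntervalClique-isIntervalClique : ∀ {I} → Valid I → IntervalClique (fullIntervalClique I)
  fullIntervalClique-isIntervalClique {I@(k , l)} valid =
    (unique , here refl , adjacent) , k , l , valid , on-I
    where
      unique : Unique (fullIntervalClique I)
      unique = All.tabulate (λ v∈ 𝐞≡v → let (x , x∈ , v≡) = ∈-map⁻ _ v∈ in
                               vec≢𝐞 valid (∈-nonIdentity⁻ x∈) (sym (trans 𝐞≡v v≡)))
             ∷ unique-map⁺ nonIdentity unique-nonIdentity (λ x∈ _ eq → proj₁ (vec-injective valid valid (∈-nonIdentity⁻ x∈) eq))
      adjacent : AllPairs Adj (fullIntervalClique I)
      adjacent = All.tabulate (λ v∈ → let (x , x∈ , v≡) = ∈-map⁻ _ v∈ in
                                 subst (Adj 𝐞) (sym v≡) (𝐞-adjacent⁺ (vec∈S valid (∈-nonIdentity⁻ x∈))))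
               ∷ allPairs-map⁺ nonIdentity unique-nonIdentity (λ x∈ _ x≢y →
                   linked⇒adjacent valid valid (∈-nonIdentity⁻ x∈) (inj₁ (refl , x≢y)))
      on-I : ∀ v → InQ* (fullIntervalClique I) v → InInterval k l v
      on-I v (here refl , v≢𝐞) = ⊥-elim (v≢𝐞 refl)
      on-I v (there v∈ , _) with ∈-map⁻ _ v∈
      ... | x , x∈ , v≡ = x , ∈-nonIdentity⁻ x∈ , v≡

  module MaximumIntervalClique (Q : List Vtx) (maximum : MaxIntervalClique Q) where

    private
      clique = proj₁ (proj₁ maximum)
      k₀ = proj₁ (proj₂ (proj₁ maximum))
      l₀ = proj₁ (proj₂ (proj₂ (proj₁ maximum)))
      on-I₀ = proj₂ (proj₂ (proj₂ (proj₂ (proj₁ maximum))))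

    I₀ : Interval
    I₀ = k₀ , l₀

    valid₀ : Valid I₀
    valid₀ = proj₁ (proj₂ (proj₂ (proj₂ (proj₁ maximum))))

    Q⊆full : Q ⊆ fullIntervalClique I₀
    Q⊆full {w} w∈Q with w ≟ᵥ 𝐞
    ... | yes refl = here refl
    ... | no w≢𝐞 with on-I₀ w (w∈Q , w≢𝐞)
    ...   | x , x≢ε , refl = there (∈-map⁺ _ (∈-nonIdentity⁺ x≢ε))

    full⊆Q : fullIntervalClique I₀ ⊆ Q
    full⊆Q = VertexCounting.unique⊆∧length≥⇒⊇ Q (fullIntervalClique I₀) (proj₁ clique) Q⊆full
               (proj₂ maximum _ (fullIntervalClique-isIntervalClique valid₀))

    vec∈Q* : ∀ {x} → x ≢ ε → InQ* Q (vec x I₀)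
    vec∈Q* x≢ε = full⊆Q (there (∈-map⁺ _ (∈-nonIdentity⁺ x≢ε))) , vec≢𝐞 valid₀ x≢ε

    N⁻ : ∀ {w} → InN Q w → ∃[ z ] ∃[ K ] Valid K × z ≢ ε × w ≡ vec z K × Touching I₀ K
    N⁻ ((k , l , vK , z , z≢ε , refl) , w∉Q* , u , u∈Q* , adj) with on-I₀ u u∈Q*
    ... | x , x≢ε , refl with adjacent⇒linked valid₀ vK x≢ε z≢ε adj
    ...   | inj₁ (refl , _) = ⊥-elim (w∉Q* (vec∈Q* z≢ε))
    ...   | inj₂ (touch , _) = z , (k , l) , vK , z≢ε , refl , touch

    N⁺ : ∀ {z K} → Valid K → z ≢ ε → Touching I₀ K → InN Q (vec z K)
    N⁺ {z} {K} vK z≢ε touch =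
      vec∈S vK z≢ε , ∉Q* , vec (transport z K I₀) I₀ , vec∈Q* (transport≢ε K I₀ z≢ε) ,
      linked⇒adjacent valid₀ vK (transport≢ε K I₀ z≢ε) (inj₂ (touch , sym (transport-involutive z K I₀)))
      where
        ∉Q* : ¬ InQ* Q (vec z K)
        ∉Q* w∈Q* with on-I₀ _ w∈Q*
        ... | x , x≢ε , eq = proj₂ touch (sym (proj₂ (vec-injective vK valid₀ z≢ε eq)))

    -- The neighbours of y_J in 𝒩(Q*), for I₀ = {a, b} and J = {a, c}: the other
    -- labels on J, the intervals {a, t} with t ∉ {a, b, c}, and {b, c}.
    module Degree {a b c : ℕ} (ra : InRange a) (rb : InRange b) (rc : InRange c)
                  (a≢b : a ≢ b) (a≢c : a ≢ c) (b≢c : b ≢ c) (I₀≡ab : I₀ ≡ edge a b) {y : C} (y≢ε : y ≢ ε) where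

      J : Interval
      J = edge a c

      vJ : Valid J
      vJ = edge-valid ra rc a≢c

      others : List ℕ
      others = pointsExcept (a ∷ b ∷ c ∷ [])

      Ks : List Interval
      Ks = edge b c ∷ map (edge a) others

      neighbours : List Vtx
      neighbours = neighbourList y J (labelsExcept (y ∷ [])) Ks

      touching₀ : ∀ {K} → Touching (edge a b) K → Touching I₀ K
      touching₀ = subst (λ I → Touching I _) (sym I₀≡ab)

      a∉bc : ¬ IsEndpoint (edge b c) a
      a∉bc = ∉-edge (a≢b ∘′ sym) (a≢c ∘′ sym)

      Ks-touching : ∀ {K} → K ∈ Ks → Valid K × Touching J K × Touching I₀ K
      Ks-touching (here refl) =
        edge-valid rb rc b≢c ,
        ((c , edge-endpointʳ a c , edge-endpointʳ b c) , λ eq → a∉bc (subst (λ K → IsEndpoint K a) eq (edge-endpointˡ a c))) ,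
        touching₀ ((b , edge-endpointʳ a b , edge-endpointˡ b c) , λ eq → a∉bc (subst (λ K → IsEndpoint K a) eq (edge-endpointˡ a b)))
      Ks-touching (there K∈) with ∈-map⁻ (edge a) K∈
      ... | t , t∈ , refl with ∈-pointsExcept₃⁻ t∈
      ...   | rt , t≢a , t≢b , t≢c =
        edge-valid ra rt (t≢a ∘′ sym) , edges-touching a≢c (t≢c ∘′ sym) , touching₀ (edges-touching a≢b (t≢b ∘′ sym))

      unique-Ks : Unique Ks
      unique-Ks = All.tabulate (λ K∈ eq → let (t , _ , K≡) = ∈-map⁻ (edge a) K∈ in
                                  a∉bc (subst (λ K → IsEndpoint K a) (sym (trans eq K≡)) (edge-endpointˡ a t)))
                ∷ unique-map⁺ others (unique-pointsExcept _) (λ t∈ _ → edge-injectiveʳ (proj₁ (proj₂ (∈-pointsExcept₃⁻ t∈))))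

      sound : ∀ w → w ∈ neighbours → InN Q w × Adj (vec y J) w
      sound w w∈ = in-N , neighbourList-adjacent vJ y≢ε (λ z∈ → proj₂ (∈-labelsExcept⁻ z∈) ∘′ here)
                                                  (λ K∈ → proj₁ (Ks-touching K∈) , proj₁ (proj₂ (Ks-touching K∈))) w∈
        where
          in-N : InN Q w
          in-N with ∈-neighbourList⁻ {y} {J} {labelsExcept (y ∷ [])} {Ks} w∈
          ... | inj₁ (z , z∈ , refl) = N⁺ vJ (proj₁ (∈-labelsExcept⁻ z∈)) (touching₀ (edges-touching a≢b b≢c))
          ... | inj₂ (K , K∈ , refl) = N⁺ (proj₁ (Ks-touching K∈)) (transport≢ε J K y≢ε) (proj₂ (proj₂ (Ks-touching K∈)))

      complete : ∀ w → InN Q w × Adj (vec y J) w → w ∈ neighbours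
      complete w (w∈N , adj) with N⁻ w∈N
      ... | z , K , vK , z≢ε , refl , touch₀ with adjacent⇒linked vJ vK y≢ε z≢ε adj
      ...   | inj₁ (refl , y≢z) = ∈-neighbourList⁺ˡ (∈-labelsExcept⁺ z≢ε λ { (here z≡y) → y≢z (sym z≡y) })
      ...   | inj₂ (touchJ , refl) with isEndpoint? K a
      ...     | yes a∈K with as-edge vK a∈K
      ...       | t , t≢a , rt , refl = ∈-neighbourList⁺ʳ (there (∈-map⁺ (edge a)
                    (∈-pointsExcept₃⁺ rt t≢a (λ { refl → proj₂ touch₀ I₀≡ab }) (λ { refl → proj₂ touchJ refl }))))
      complete w (w∈N , adj) | z , K , vK , z≢ε , refl , touch₀ | inj₂ (touchJ , refl) | no a∉K =
        subst (λ K′ → vec (transport y J K′) K′ ∈ neighbours) (sym K≡bc) (∈-neighbourList⁺ʳ (here refl))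
        where
          K≡bc : K ≡ edge b c
          K≡bc = edge-unique vK (touching-edge-other (subst (λ I → Touching I K) I₀≡ab touch₀) a∉K) (touching-edge-other touchJ a∉K) b≢c

      length-neighbours : length neighbours ≡ 2 * m ∸ 2
      length-neighbours = begin
        length neighbours                       ≡⟨ length-neighbourList y J labels Ks ⟩
        length labels + suc (length (map (edge a) others)) ≡⟨ cong (λ k → length labels + suc k) (length-map (edge a) others) ⟩
        length labels + suc (length others)     ≡⟨ cong (length labels +_) |others|+1≡|labels| ⟩
        length labels + length labels           ≡⟨ sym (twice∸2 (length labels)) ⟩
        2 * suc (length labels) ∸ 2             ≡⟨ cong (λ k → 2 * k ∸ 2) 1+|labels|≡m ⟩
        2 * m ∸ 2                               ∎
        where
          open ≡-Reasoning
          labels = labelsExcept (y ∷ [])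
          1+|labels|≡m : suc (length labels) ≡ m
          1+|labels|≡m = length-labelsExcept ([] ∷ []) λ { (here refl) → y≢ε }
          |others|+1≡|labels| : suc (length others) ≡ length labels
          |others|+1≡|labels| = suc-injective (trans (length-pointsExcept₃ ra rb rc a≢b a≢c b≢c) (sym 1+|labels|≡m))

      hasSize : DegreeInN Q (vec y J) (2 * m ∸ 2)
      hasSize = neighbours ,
        unique-neighbourList y≢ε vJ (unique-labelsExcept _) unique-Ks (proj₁ ∘′ ∈-labelsExcept⁻)
          (λ K∈ → proj₁ (Ks-touching K∈) , λ K≡J → proj₂ (proj₁ (proj₂ (Ks-touching K∈))) (sym K≡J)) ,
        (λ w → mk⇔ (sound w) (complete w)) ,
        length-neighbours

    regular : RegularOfDegree Q (2 * m ∸ 2)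
    regular v v∈N with N⁻ v∈N
    ... | y , K , vK , y≢ε , refl , ((p , p∈I₀ , p∈K) , I₀≢K) with as-edge valid₀ p∈I₀ | as-edge vK p∈K
    ...   | b , b≢p , rb , I₀≡pb | c , c≢p , rc , refl =
      Degree.hasSize (endpoint-inRange valid₀ p∈I₀) rb rc (b≢p ∘′ sym) (c≢p ∘′ sym)
        (λ b≡c → I₀≢K (trans I₀≡pb (cong (edge p) b≡c))) I₀≡pb y≢ε

module DispersedCliques (m : ℕ) (G : FinGroup (suc m)) where
  open CliqueSetting m G

  starClique : C → List Vtx
  starClique g = 𝐞 ∷ map (λ t → vec g (edge 1 t)) (pointsExcept (1 ∷ []))

  1∈range : InRange 1
  1∈range = s≤s z≤n , s≤s z≤n

  length-starClique : ∀ g → length (starClique g) ≡ suc m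
  length-starClique g = cong suc (trans (length-map _ (pointsExcept (1 ∷ [])))
    (suc-injective (length-pointsExcept ([] ∷ []) λ { (here refl) → 1∈range })))

  starClique-isDispersed : 2 ≤ m → ∀ {g} → g ≢ ε → DispersedClique (starClique g)
  starClique-isDispersed 2≤m {g} g≢ε =
    (unique , here refl , adjacent) , vec g (1 , 2) , vec g (1 , 3) , 1 , 2 , 1 , 3 ,
    star-member 2∈ , star-member 3∈ , valid-star 2∈ , valid-star 3∈ , (g , g≢ε , refl) , (g , g≢ε , refl) , λ ()
    where
      ∈-star⁻ : ∀ {t} → t ∈ pointsExcept (1 ∷ []) → InRange t × t ≢ 1
      ∈-star⁻ t∈ = proj₁ (∈-pointsExcept⁻ t∈) , proj₂ (∈-pointsExcept⁻ t∈) ∘′ here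
      valid-star : ∀ {t} → t ∈ pointsExcept (1 ∷ []) → Valid (edge 1 t)
      valid-star t∈ = edge-valid 1∈range (proj₁ (∈-star⁻ t∈)) (proj₂ (∈-star⁻ t∈) ∘′ sym)
      2∈ : 2 ∈ pointsExcept (1 ∷ [])
      2∈ = ∈-pointsExcept⁺ (s≤s z≤n , s≤s (≤-trans (s≤s z≤n) 2≤m)) λ { (here ()) ; (there ()) }
      3∈ : 3 ∈ pointsExcept (1 ∷ [])
      3∈ = ∈-pointsExcept⁺ (s≤s z≤n , s≤s 2≤m) λ { (here ()) ; (there ()) }
      starts-at-1 : ∀ {t} → t ∈ pointsExcept (1 ∷ []) → proj₁ (edge 1 t) ≡ 1
      starts-at-1 t∈ = m≤n⇒m⊓n≡m (proj₁ (proj₁ (∈-star⁻ t∈)))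
      star-member : ∀ {t} → t ∈ pointsExcept (1 ∷ []) → InQ* (starClique g) (vec g (edge 1 t))
      star-member t∈ = there (∈-map⁺ _ t∈) , vec≢𝐞 (valid-star t∈) g≢ε
      unique : Unique (starClique g)
      unique = All.tabulate (λ v∈ 𝐞≡v → let (t , t∈ , v≡) = ∈-map⁻ _ v∈ in
                               vec≢𝐞 (valid-star t∈) g≢ε (sym (trans 𝐞≡v v≡)))
             ∷ unique-map⁺ _ (unique-pointsExcept _) (λ t∈ t′∈ eq →
                 edge-injectiveʳ (proj₂ (∈-star⁻ t∈)) (proj₂ (vec-injective (valid-star t∈) (valid-star t′∈) g≢ε eq)))
      adjacent : AllPairs Adj (starClique g)
      adjacent = All.tabulate (λ v∈ → let (t , t∈ , v≡) = ∈-map⁻ _ v∈ in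
                                 subst (Adj 𝐞) (sym v≡) (𝐞-adjacent⁺ (vec∈S (valid-star t∈) g≢ε)))
               ∷ allPairs-map⁺ _ (unique-pointsExcept _) (λ t∈ t′∈ t≢t′ →
                   linked⇒adjacent (valid-star t∈) (valid-star t′∈) g≢ε
                     (inj₂ (edges-touching (proj₂ (∈-star⁻ t∈) ∘′ sym) t≢t′ ,
                            sym (transport-aligned g (inj₁ (trans (starts-at-1 t∈) (sym (starts-at-1 t′∈))))))))

  -- A clique containing x₀_{ab} and its transport to {a, c}; the labels of all
  -- members are then forced, and its intervals form a star at a or the triangle abc.
  module TwoMembers (Q : List Vtx) (clique : CliqueWithE Q) {x₀ : C} {a b c : ℕ}
                    (ra : InRange a) (rb : InRange b) (rc : InRange c) (a≢b : a ≢ b) (a≢c : a ≢ c) (b≢c : b ≢ c)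
                    (x₀≢ε : x₀ ≢ ε) (u₀∈Q : vec x₀ (edge a b) ∈ Q)
                    (v₀∈Q : vec (transport x₀ (edge a b) (edge a c)) (edge a c) ∈ Q) where
    open Clique Q clique

    AB AC BC : Interval
    AB = edge a b
    AC = edge a c
    BC = edge b c

    vAB : Valid AB
    vAB = edge-valid ra rb a≢b
    vAC : Valid AC
    vAC = edge-valid ra rc a≢c
    vBC : Valid BC
    vBC = edge-valid rb rc b≢c

    y₀ z₂ : C
    y₀ = transport x₀ AB AC
    z₂ = transport x₀ AB BC

    y₀≢ε : y₀ ≢ ε
    y₀≢ε = transport≢ε AB AC x₀≢ε
    z₂≢ε : z₂ ≢ ε
    z₂≢ε = transport≢ε AB BC x₀≢ε

    u₀ v₀ w₃ : Vtx
    u₀ = vec x₀ AB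
    v₀ = vec y₀ AC
    w₃ = vec z₂ BC

    u₀∈Q* : InQ* Q u₀
    u₀∈Q* = u₀∈Q , vec≢𝐞 vAB x₀≢ε
    v₀∈Q* : InQ* Q v₀
    v₀∈Q* = v₀∈Q , vec≢𝐞 vAC y₀≢ε

    a∉BC : ¬ IsEndpoint BC a
    a∉BC = ∉-edge (a≢b ∘′ sym) (a≢c ∘′ sym)

    AB≢AC : AB ≢ AC
    AB≢AC = proj₂ (edges-touching a≢b b≢c)

    AB-touches-BC : Touching AB BC
    AB-touches-BC = (b , edge-endpointʳ a b , edge-endpointˡ b c) , λ eq → a∉BC (subst (λ K → IsEndpoint K a) eq (edge-endpointˡ a b))

    AC-touches-BC : Touching AC BC
    AC-touches-BC = (c , edge-endpointʳ a c , edge-endpointʳ b c) , λ eq → a∉BC (subst (λ K → IsEndpoint K a) eq (edge-endpointˡ a c))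

    on-AB : ∀ {z K} → Valid K → z ≢ ε → vec z K ∈ Q → (K ≡ AB ⊎ Touching AB K) × z ≡ transport x₀ AB K
    on-AB vK z≢ε = member-transport vAB vAC vK x₀≢ε y₀≢ε z≢ε AB≢AC u₀∈Q v₀∈Q

    on-AC : ∀ {z K} → Valid K → z ≢ ε → vec z K ∈ Q → (K ≡ AC ⊎ Touching AC K) × z ≡ transport y₀ AC K
    on-AC vK z≢ε = member-transport vAC vAB vK y₀≢ε x₀≢ε z≢ε (AB≢AC ∘′ sym) v₀∈Q u₀∈Q

    not-member : ∀ {z K} → Valid K → z ≢ ε → transport x₀ AB K ≢ z → ¬ InQ* Q (vec z K)
    not-member vK z≢ε z≢ (z∈Q , _) = z≢ (sym (proj₂ (on-AB vK z≢ε z∈Q)))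

    touching-AB-AC : ∀ {K} → Valid K → Touching AB K → Touching AC K → ¬ IsEndpoint K a → K ≡ BC
    touching-AB-AC vK touchAB touchAC a∉K = edge-unique vK (touching-edge-other touchAB a∉K) (touching-edge-other touchAC a∉K) b≢c

    triangle-untouchable : ∀ {K} → Valid K → Touching AB K → Touching AC K → Touching BC K → ⊥
    triangle-untouchable vK touchAB touchAC touchBC with touching-edge touchAB | touching-edge touchAC | touching-edge touchBC
    ... | inj₁ a∈K | _ | inj₁ b∈K = proj₂ touchAB (sym (edge-unique vK a∈K b∈K a≢b))
    ... | inj₁ a∈K | _ | inj₂ c∈K = proj₂ touchAC (sym (edge-unique vK a∈K c∈K a≢c))
    ... | inj₂ b∈K | inj₁ a∈K | _ = proj₂ touchAB (sym (edge-unique vK a∈K b∈K a≢b))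
    ... | inj₂ b∈K | inj₂ c∈K | _ = proj₂ touchBC (sym (edge-unique vK b∈K c∈K b≢c))

    σ : ℕ → C
    σ t = transport x₀ AB (edge a t)

    starList : List Vtx
    starList = map (λ t → vec (σ t) (edge a t)) (pointsExcept (a ∷ []))

    length-starList : length starList ≡ m
    length-starList = trans (length-map _ (pointsExcept (a ∷ [])))
      (suc-injective (length-pointsExcept ([] ∷ []) λ { (here refl) → ra }))

    members⊆starList : w₃ ∉ Q → members ⊆ starList
    members⊆starList w₃∉Q w∈ with member∈S (∈-members⁻ w∈)
    ... | k , l , vK , z , z≢ε , refl with on-AB vK z≢ε (proj₁ (∈-members⁻ w∈)) | isEndpoint? (k , l) a
    ...   | _ , z≡ | yes a∈K with as-edge vK a∈K
    ...     | t , t≢a , rt , refl = subst (_∈ starList) (cong (λ s → vec s (edge a t)) (sym z≡))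
                                      (∈-map⁺ _ (∈-pointsExcept⁺ rt λ { (here t≡a) → t≢a t≡a }))
    members⊆starList w₃∉Q w∈ | k , l , vK , z , z≢ε , refl | inj₁ refl , _ | no a∉K = ⊥-elim (a∉K (edge-endpointˡ a b))
    members⊆starList w₃∉Q w∈ | k , l , vK , z , z≢ε , refl | inj₂ touchAB , z≡ | no a∉K
      with on-AC vK z≢ε (proj₁ (∈-members⁻ w∈))
    ... | inj₁ refl , _ = ⊥-elim (a∉K (edge-endpointˡ a c))
    ... | inj₂ touchAC , _ with touching-AB-AC vK touchAB touchAC a∉K
    ...   | refl = ⊥-elim (w₃∉Q (subst (λ s → vec s BC ∈ Q) z≡ (proj₁ (∈-members⁻ w∈))))

    members⊆triangle : w₃ ∈ Q → members ⊆ (u₀ ∷ v₀ ∷ w₃ ∷ [])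
    members⊆triangle w₃∈Q w∈ with member∈S (∈-members⁻ w∈)
    ... | k , l , vK , z , z≢ε , refl with on-AB vK z≢ε (proj₁ (∈-members⁻ w∈))
    ...   | inj₁ refl , z≡ = here (cong (λ s → vec s AB) (trans z≡ (transport-refl x₀ AB)))
    ...   | inj₂ touchAB , z≡ with on-AC vK z≢ε (proj₁ (∈-members⁻ w∈))
    ...     | inj₁ refl , _ = there (here (cong (λ s → vec s AC) z≡))
    ...     | inj₂ touchAC , _ with (k , l) ≟ᵢ BC
    ...       | yes refl = there (there (here (cong (λ s → vec s BC) z≡)))
    ...       | no K≢BC with members-linked vBC vK z₂≢ε z≢ε w₃∈Q (proj₁ (∈-members⁻ w∈))
                               (λ eq → K≢BC (sym (proj₂ (vec-injective vBC vK z₂≢ε eq))))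
    ...         | inj₁ (BC≡K , _) = ⊥-elim (K≢BC (sym BC≡K))
    ...         | inj₂ (touchBC , _) = ⊥-elim (triangle-untouchable vK touchAB touchAC touchBC)

    in-N : ∀ {z K u} → Valid K → z ≢ ε → transport x₀ AB K ≢ z → InQ* Q u → Adj u (vec z K) → InN Q (vec z K)
    in-N vK z≢ε z≢ u∈Q* adj = vec∈S vK z≢ε , not-member vK z≢ε z≢ , _ , u∈Q* , adj

    rest : List ℕ
    rest = pointsExcept (a ∷ b ∷ c ∷ [])

    m≡2+|rest| : m ≡ suc (suc (length rest))
    m≡2+|rest| = sym (length-pointsExcept₃ ra rb rc a≢b a≢c b≢c)

    -- Neighbours of y_{ab} (y ≠ x₀) in 𝒩(Q*): relabellings of {a, b}, and transports to the
    -- intervals K whose transport of x₀ is a member.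
    module AroundAB {y : C} (y≢ε : y ≢ ε) (y≢x₀ : y ≢ x₀) (Ks : List Interval) (unique-Ks : Unique Ks)
                    (Ks-ok : ∀ {K} → K ∈ Ks → Valid K × Touching AB K × vec (transport x₀ AB K) K ∈ Q) where

      v₁ : Vtx
      v₁ = vec y AB

      v₁∈N : InN Q v₁
      v₁∈N = in-N vAB y≢ε (λ eq → y≢x₀ (sym (trans (sym (transport-refl x₀ AB)) eq))) u₀∈Q*
               (linked⇒adjacent vAB vAB x₀≢ε (inj₁ (refl , y≢x₀ ∘′ sym)))

      labels₁ : List C
      labels₁ = labelsExcept (y ∷ x₀ ∷ [])

      neighbours₁ : List Vtx
      neighbours₁ = neighbourList y AB labels₁ Ks

      length-labels₁ : length labels₁ ≡ length rest
      length-labels₁ = suc-injective (suc-injective (trans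
        (length-labelsExcept ((y≢x₀ ∷ []) ∷ [] ∷ []) λ { (here refl) → y≢ε ; (there (here refl)) → x₀≢ε })
        m≡2+|rest|))

      sound₁ : ∀ w → w ∈ neighbours₁ → InN Q w × Adj v₁ w
      sound₁ w w∈ = in-N′ , neighbourList-adjacent vAB y≢ε (λ z∈ → proj₂ (∈-labelsExcept⁻ z∈) ∘′ here)
                                                    (λ K∈ → proj₁ (Ks-ok K∈) , proj₁ (proj₂ (Ks-ok K∈))) w∈
        where
          in-N′ : InN Q w
          in-N′ with ∈-neighbourList⁻ {y} {AB} {labels₁} {Ks} w∈
          ... | inj₁ (z , z∈ , refl) with ∈-labelsExcept⁻ z∈
          ...   | z≢ε , z∉ = in-N vAB z≢ε (λ eq → z∉ (there (here (sym (trans (sym (transport-refl x₀ AB)) eq))))) u₀∈Q*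
                               (linked⇒adjacent vAB vAB x₀≢ε (inj₁ (refl , λ x₀≡z → z∉ (there (here (sym x₀≡z))))))
          in-N′ | inj₂ (K , K∈ , refl) with Ks-ok K∈
          ...   | vK , _ , member∈Q = in-N vK (transport≢ε AB K y≢ε) labels-differ
                    (member∈Q , vec≢𝐞 vK (transport≢ε AB K x₀≢ε))
                    (linked⇒adjacent vK vK (transport≢ε AB K x₀≢ε) (inj₁ (refl , labels-differ)))
            where
              labels-differ : transport x₀ AB K ≢ transport y AB K
              labels-differ eq = y≢x₀ (sym (transport-injective x₀ y AB K eq))

      unique₁ : Unique neighbours₁
      unique₁ = unique-neighbourList y≢ε vAB (unique-labelsExcept _) unique-Ks (proj₁ ∘′ ∈-labelsExcept⁻)
                  (λ K∈ → proj₁ (Ks-ok K∈) , λ K≡AB → proj₂ (proj₁ (proj₂ (Ks-ok K∈))) (sym K≡AB))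

      length₁ : length neighbours₁ ≡ length rest + length Ks
      length₁ = trans (length-neighbourList y AB labels₁ Ks) (cong (_+ length Ks) length-labels₁)

      degree≥ : ∀ {d} → DegreeInN Q v₁ d → length rest + length Ks ≤ d
      degree≥ size = subst (_≤ _) length₁ (VertexCounting.length≤size size neighbours₁ unique₁ sound₁)

    module Star (w₃∉Q : w₃ ∉ Q) (m≤|members| : m ≤ length members) where

      starList⊆members : starList ⊆ members
      starList⊆members = VertexCounting.unique⊆∧length≥⇒⊇ members starList unique-members (members⊆starList w₃∉Q)
                           (subst (_≤ length members) (sym length-starList) m≤|members|)

      σ-member : ∀ {t} → InRange t → t ≢ a → vec (σ t) (edge a t) ∈ Q
      σ-member rt t≢a = proj₁ (∈-members⁻ (starList⊆members (∈-map⁺ _ (∈-pointsExcept⁺ rt λ { (here t≡a) → t≢a t≡a }))))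

      member-on-star : ∀ {w} → InQ* Q w → ∃[ s ] InRange s × s ≢ a × w ≡ vec (σ s) (edge a s)
      member-on-star w∈Q* with ∈-map⁻ _ (members⊆starList w₃∉Q (∈-members⁺ w∈Q*))
      ... | s , s∈ , w≡ = s , proj₁ (∈-pointsExcept⁻ s∈) , proj₂ (∈-pointsExcept⁻ s∈) ∘′ here , w≡

      σ-valid : ∀ {s} → InRange s → s ≢ a → Valid (edge a s)
      σ-valid rs s≢a = edge-valid ra rs (s≢a ∘′ sym)

      σ≢ε : ∀ s → σ s ≢ ε
      σ≢ε s = transport≢ε AB (edge a s) x₀≢ε

      not-member-away : ∀ {z K} → Valid K → z ≢ ε → ¬ IsEndpoint K a → ¬ InQ* Q (vec z K)
      not-member-away vK z≢ε a∉K w∈Q* with member-on-star w∈Q*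
      ... | s , rs , s≢a , eq =
        a∉K (subst (λ K′ → IsEndpoint K′ a) (sym (proj₂ (vec-injective vK (σ-valid rs s≢a) z≢ε eq))) (edge-endpointˡ a s))

      in-N-away : ∀ {z K u} → Valid K → z ≢ ε → ¬ IsEndpoint K a → InQ* Q u → Adj u (vec z K) → InN Q (vec z K)
      in-N-away vK z≢ε a∉K u∈Q* adj = vec∈S vK z≢ε , not-member-away vK z≢ε a∉K , _ , u∈Q* , adj

      module V₁ {y : C} (y≢ε : y ≢ ε) (y≢x₀ : y ≢ x₀) (y≢x₀⁻¹ : y ≢ x₀ ⁻¹) where

        Ks₁ : List Interval
        Ks₁ = AC ∷ map (edge a) rest

        Ks₁-ok : ∀ {K} → K ∈ Ks₁ → Valid K × Touching AB K × vec (transport x₀ AB K) K ∈ Q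
        Ks₁-ok (here refl) = vAC , edges-touching a≢b b≢c , v₀∈Q
        Ks₁-ok (there K∈) with ∈-map⁻ (edge a) K∈
        ... | t , t∈ , refl with ∈-pointsExcept₃⁻ t∈
        ...   | rt , t≢a , t≢b , _ = σ-valid rt t≢a , edges-touching a≢b (t≢b ∘′ sym) , σ-member rt t≢a

        unique-Ks₁ : Unique Ks₁
        unique-Ks₁ = All.tabulate (λ K∈ AC≡K → let (t , t∈ , K≡) = ∈-map⁻ (edge a) K∈ in
                                     proj₂ (proj₂ (proj₂ (∈-pointsExcept₃⁻ t∈))) (sym (edge-injectiveʳ (a≢c ∘′ sym) (trans AC≡K K≡))))
                   ∷ unique-map⁺ rest (unique-pointsExcept _) (λ t∈ _ → edge-injectiveʳ (proj₁ (proj₂ (∈-pointsExcept₃⁻ t∈))))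

        open AroundAB y≢ε y≢x₀ Ks₁ unique-Ks₁ Ks₁-ok public

        length-Ks₁ : length Ks₁ ≡ suc (length rest)
        length-Ks₁ = cong suc (length-map (edge a) rest)

        complete₁ : ∀ w → InN Q w × Adj v₁ w → w ∈ neighbours₁
        complete₁ w ((w∈S , w∉Q* , u , u∈Q* , u-adj) , adj) with w∈S
        ... | k , l , vK , z , z≢ε , refl with adjacent⇒linked vAB vK y≢ε z≢ε adj
        ...   | inj₁ (refl , y≢z) = ∈-neighbourList⁺ˡ (∈-labelsExcept⁺ z≢ε λ
                  { (here z≡y) → y≢z (sym z≡y) ; (there (here refl)) → w∉Q* u₀∈Q* })
        ...   | inj₂ (touchAB , refl) with isEndpoint? (k , l) a
        ...     | yes a∈K with as-edge vK a∈K
        ...       | t , t≢a , rt , refl with t ≟ c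
        ...         | yes refl = ∈-neighbourList⁺ʳ (here refl)
        ...         | no t≢c = ∈-neighbourList⁺ʳ (there (∈-map⁺ (edge a)
                                   (∈-pointsExcept₃⁺ rt t≢a (λ { refl → proj₂ touchAB refl }) t≢c)))
        complete₁ w ((w∈S , w∉Q* , u , u∈Q* , u-adj) , adj) | k , l , vK , z , z≢ε , refl | inj₂ (touchAB , refl) | no a∉K
          with as-edge vK (touching-edge-other touchAB a∉K) | member-on-star u∈Q*
        ... | t , t≢b , rt , refl | s , rs , s≢a , refl with adjacent⇒linked (σ-valid rs s≢a) vK (σ≢ε s) z≢ε u-adj
        ...   | inj₁ (as≡bt , _) = ⊥-elim (a∉K (subst (λ K → IsEndpoint K a) as≡bt (edge-endpointˡ a s)))
        ...   | inj₂ (touch , y-transported) with touching-edge touch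
        ...     | inj₁ a∈K = ⊥-elim (a∉K a∈K)
        ...     | inj₂ s∈K with edge-endpoint⁻ s∈K
        ...       | inj₁ refl = ⊥-elim (y≢x₀ (transport-injective y x₀ AB (edge b t)
                                   (trans y-transported (cong (λ x → transport x AB (edge b t)) (transport-refl x₀ AB)))))
        ...       | inj₂ refl = ⊥-elim (y≢x₀⁻¹ (transport-injective y (x₀ ⁻¹) AB (edge b t) (begin
                      transport y AB (edge b t)                         ≡⟨ y-transported ⟩
                      transport (σ t) (edge a t) (edge b t)             ≡⟨ transport-triangle x₀ a≢b (s≢a ∘′ sym) (t≢b ∘′ sym) ⟩
                      transport x₀ AB (edge b t) ⁻¹                     ≡⟨ sym (transport-⁻¹ x₀ AB (edge b t)) ⟩
                      transport (x₀ ⁻¹) AB (edge b t)                   ∎)))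
          where open ≡-Reasoning

        degree≤ : ∀ {d} → DegreeInN Q v₁ d → d ≤ length rest + suc (length rest)
        degree≤ size = subst (_ ≤_) (trans length₁ (cong (length rest +_) length-Ks₁))
                         (VertexCounting.size≤length size neighbours₁ complete₁)

      v₂ : Vtx
      v₂ = w₃

      v₂∈N : InN Q v₂
      v₂∈N = in-N-away vBC z₂≢ε a∉BC u₀∈Q* (linked⇒adjacent vAB vBC x₀≢ε (inj₂ (AB-touches-BC , refl)))

      z₂⁻¹≡ : transport y₀ AC BC ≡ z₂ ⁻¹
      z₂⁻¹≡ = transport-triangle x₀ a≢b a≢c b≢c

      edges-b : List Interval
      edges-b = map (edge b) rest

      edges-c : List Interval
      edges-c = map (edge c) rest

      ∈-edges⁻ : ∀ {K} → K ∈ edges-b ++ edges-c →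
        ∃[ r ] (InRange r × r ≢ a × r ≢ b × r ≢ c) × (K ≡ edge b r ⊎ K ≡ edge c r)
      ∈-edges⁻ K∈ with ∈-++⁻ edges-b K∈
      ... | inj₁ K∈b = let (r , r∈ , K≡) = ∈-map⁻ (edge b) K∈b in r , ∈-pointsExcept₃⁻ r∈ , inj₁ K≡
      ... | inj₂ K∈c = let (r , r∈ , K≡) = ∈-map⁻ (edge c) K∈c in r , ∈-pointsExcept₃⁻ r∈ , inj₂ K≡

      a∉edges : ∀ {K} → K ∈ edges-b ++ edges-c → ¬ IsEndpoint K a
      a∉edges K∈ with ∈-edges⁻ K∈
      ... | r , (_ , r≢a , _ , _) , inj₁ refl = ∉-edge (a≢b ∘′ sym) r≢a
      ... | r , (_ , r≢a , _ , _) , inj₂ refl = ∉-edge (a≢c ∘′ sym) r≢a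

      edges-ok : ∀ {K} → K ∈ edges-b ++ edges-c → Valid K × Touching BC K
      edges-ok K∈ with ∈-edges⁻ K∈
      ... | r , (rr , _ , r≢b , r≢c) , inj₁ refl = edge-valid rb rr (r≢b ∘′ sym) , edges-touching b≢c (r≢c ∘′ sym)
      ... | r , (rr , _ , r≢b , r≢c) , inj₂ refl =
        edge-valid rc rr (r≢c ∘′ sym) , subst (λ I → Touching I (edge c r)) (edge-comm c b) (edges-touching (b≢c ∘′ sym) (r≢b ∘′ sym))

      unique-edges : Unique (edges-b ++ edges-c)
      unique-edges =
        ++⁺ (unique-map⁺ rest (unique-pointsExcept _) (λ r∈ _ → edge-injectiveʳ (proj₁ (proj₂ (proj₂ (∈-pointsExcept₃⁻ r∈))))))
            (unique-map⁺ rest (unique-pointsExcept _) (λ r∈ _ → edge-injectiveʳ (proj₂ (proj₂ (proj₂ (∈-pointsExcept₃⁻ r∈))))))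
                         disjoint
        where
          disjoint : ∀ {K} → ¬ (K ∈ edges-b × K ∈ edges-c)
          disjoint (K∈b , K∈c) with ∈-map⁻ (edge b) K∈b | ∈-map⁻ (edge c) K∈c
          ... | r , r∈ , refl | r′ , r′∈ , K≡ =
            ∉-edge b≢c (proj₂ (proj₂ (proj₂ (∈-pointsExcept₃⁻ r∈)))) (subst (λ K → IsEndpoint K c) (sym K≡) (edge-endpointˡ c r′))

      length-edges : length (edges-b ++ edges-c) ≡ length rest + length rest
      length-edges = trans (length-++ edges-b) (cong₂ _+_ (length-map (edge b) rest) (length-map (edge c) rest))

      -- Transport from z₂_{bc} to {b, r} and {c, r} agrees with transport from the star members
      -- x₀_{ab} and σ(r)_{ar}, by path independence and the triangle rule.
      transport-via-b : ∀ {r} → r ≢ b → transport z₂ BC (edge b r) ≡ transport x₀ AB (edge b r)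
      transport-via-b {r} r≢b = begin
        transport z₂ BC (edge b r)
          ≡⟨ cong (λ I → transport (transport x₀ I BC) BC (edge b r)) (edge-comm a b) ⟩
        transport (transport x₀ (edge b a) BC) BC (edge b r)
          ≡⟨ transport-trans x₀ (a≢b ∘′ sym) b≢c (r≢b ∘′ sym) ⟩
        transport x₀ (edge b a) (edge b r)
          ≡⟨ cong (λ I → transport x₀ I (edge b r)) (edge-comm b a) ⟩
        transport x₀ AB (edge b r) ∎
        where open ≡-Reasoning

      transport-via-c : ∀ {r} → r ≢ a → r ≢ c → transport z₂ BC (edge c r) ≡ transport (σ r) (edge a r) (edge c r)
      transport-via-c {r} r≢a r≢c = begin
        transport z₂ BC (edge c r)
          ≡⟨ cong (λ x → transport x BC (edge c r)) z₂≡ ⟩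
        transport (transport y₀ AC BC ⁻¹) BC (edge c r)
          ≡⟨ transport-⁻¹ (transport y₀ AC BC) BC (edge c r) ⟩
        transport (transport y₀ AC BC) BC (edge c r) ⁻¹
          ≡⟨ cong (_⁻¹) around-c ⟩
        transport y₀ AC (edge c r) ⁻¹
          ≡⟨ sym (transport-triangle y₀ a≢c (r≢a ∘′ sym) (r≢c ∘′ sym)) ⟩
        transport (transport y₀ AC (edge a r)) (edge a r) (edge c r)
          ≡⟨ cong (λ x → transport x (edge a r) (edge c r)) (transport-trans x₀ a≢b a≢c (r≢a ∘′ sym)) ⟩
        transport (σ r) (edge a r) (edge c r) ∎
        where
          open ≡-Reasoning
          z₂≡ : z₂ ≡ transport y₀ AC BC ⁻¹
          z₂≡ = trans (sym (⁻¹-involutive z₂)) (cong (_⁻¹) (sym z₂⁻¹≡))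
          around-c : transport (transport y₀ AC BC) BC (edge c r) ≡ transport y₀ AC (edge c r)
          around-c = begin
            transport (transport y₀ AC BC) BC (edge c r)
              ≡⟨ cong₂ (λ I J → transport (transport y₀ I J) J (edge c r)) (edge-comm a c) (edge-comm b c) ⟩
            transport (transport y₀ (edge c a) (edge c b)) (edge c b) (edge c r)
              ≡⟨ transport-trans y₀ (a≢c ∘′ sym) (b≢c ∘′ sym) (r≢c ∘′ sym) ⟩
            transport y₀ (edge c a) (edge c r)
              ≡⟨ cong (λ I → transport y₀ I (edge c r)) (edge-comm c a) ⟩
            transport y₀ AC (edge c r) ∎

      module V₂-lower (x₀≢x₀⁻¹ : x₀ ≢ x₀ ⁻¹) where

        z₂≢z₂⁻¹ : z₂ ≢ z₂ ⁻¹
        z₂≢z₂⁻¹ eq = x₀≢x₀⁻¹ (transport-injective x₀ (x₀ ⁻¹) AB BC (trans eq (sym (transport-⁻¹ x₀ AB BC))))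

        Ks₂ : List Interval
        Ks₂ = AC ∷ (edges-b ++ edges-c)

        neighbours₂ : List Vtx
        neighbours₂ = neighbourList z₂ BC (z₂ ⁻¹ ∷ []) Ks₂

        Ks₂-ok : ∀ {K} → K ∈ Ks₂ → Valid K × Touching BC K
        Ks₂-ok (here refl) = vAC , touching-sym AC-touches-BC
        Ks₂-ok (there K∈) = edges-ok K∈

        unique-Ks₂ : Unique Ks₂
        unique-Ks₂ = All.tabulate (λ K∈ AC≡K → a∉edges K∈ (subst (λ K → IsEndpoint K a) AC≡K (edge-endpointˡ a c))) ∷ unique-edges

        y₀≢ : y₀ ≢ transport z₂ BC AC
        y₀≢ eq = z₂≢z₂⁻¹ (begin
          z₂                                        ≡⟨ sym (transport-involutive z₂ BC AC) ⟩
          transport (transport z₂ BC AC) AC BC      ≡⟨ cong (λ x → transport x AC BC) (sym eq) ⟩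
          transport y₀ AC BC                        ≡⟨ z₂⁻¹≡ ⟩
          z₂ ⁻¹                                     ∎)
          where open ≡-Reasoning

        in-N₂ : ∀ {w} → w ∈ neighbours₂ → InN Q w
        in-N₂ {w} w∈ with ∈-neighbourList⁻ {z₂} {BC} {z₂ ⁻¹ ∷ []} {Ks₂} w∈
        ... | inj₁ (_ , here refl , refl) =
          in-N-away vBC (⁻¹≢ε z₂≢ε) a∉BC v₀∈Q* (linked⇒adjacent vAC vBC y₀≢ε (inj₂ (AC-touches-BC , sym z₂⁻¹≡)))
        ... | inj₂ (_ , here refl , refl) =
          in-N vAC (transport≢ε BC AC z₂≢ε) y₀≢ v₀∈Q* (linked⇒adjacent vAC vAC y₀≢ε (inj₁ (refl , y₀≢)))
        ... | inj₂ (K , there K∈ , refl) with ∈-edges⁻ K∈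
        ...   | r , (rr , r≢a , r≢b , r≢c) , inj₁ refl =
          in-N-away (proj₁ (edges-ok K∈)) (transport≢ε BC K z₂≢ε) (a∉edges K∈) u₀∈Q*
            (linked⇒adjacent vAB (proj₁ (edges-ok K∈)) x₀≢ε (inj₂ (touch , transport-via-b r≢b)))
          where
            touch : Touching AB (edge b r)
            touch = (b , edge-endpointʳ a b , edge-endpointˡ b r) , λ eq → a∉edges K∈ (subst (λ K → IsEndpoint K a) eq (edge-endpointˡ a b))
        ...   | r , (rr , r≢a , r≢b , r≢c) , inj₂ refl =
          in-N-away (proj₁ (edges-ok K∈)) (transport≢ε BC K z₂≢ε) (a∉edges K∈)
            (σ-member rr r≢a , vec≢𝐞 (σ-valid rr r≢a) (σ≢ε r))
            (linked⇒adjacent (σ-valid rr r≢a) (proj₁ (edges-ok K∈)) (σ≢ε r) (inj₂ (touch , transport-via-c r≢a r≢c)))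
          where
            touch : Touching (edge a r) (edge c r)
            touch = (r , edge-endpointʳ a r , edge-endpointʳ c r) , λ eq → a∉edges K∈ (subst (λ K → IsEndpoint K a) eq (edge-endpointˡ a r))

        sound₂ : ∀ w → w ∈ neighbours₂ → InN Q w × Adj v₂ w
        sound₂ w w∈ = in-N₂ w∈ , neighbourList-adjacent vBC z₂≢ε (λ { (here refl) eq → z₂≢z₂⁻¹ (sym eq) }) Ks₂-ok w∈

        degree≥ : ∀ {d} → DegreeInN Q v₂ d → suc (length rest) + suc (length rest) ≤ d
        degree≥ size = subst (_≤ _) length₂
          (VertexCounting.length≤size size neighbours₂
            (unique-neighbourList z₂≢ε vBC ([] ∷ []) unique-Ks₂ (λ { (here refl) → ⁻¹≢ε z₂≢ε })
              (λ K∈ → proj₁ (Ks₂-ok K∈) , λ K≡BC → proj₂ (proj₂ (Ks₂-ok K∈)) (sym K≡BC)))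
            sound₂)
          where
            length₂ : length neighbours₂ ≡ suc (length rest) + suc (length rest)
            length₂ = trans (length-neighbourList z₂ BC (z₂ ⁻¹ ∷ []) Ks₂)
                        (trans (cong (suc ∘′ suc) length-edges) (cong suc (sym (+-suc (length rest) (length rest)))))

      module V₂-upper (x₀≡x₀⁻¹ : x₀ ≡ x₀ ⁻¹) where

        z₂⁻¹≡z₂ : z₂ ⁻¹ ≡ z₂
        z₂⁻¹≡z₂ = trans (sym (transport-⁻¹ x₀ AB BC)) (cong (λ x → transport x AB BC) (sym x₀≡x₀⁻¹))

        upperList : List Vtx
        upperList = map (λ K → vec (transport z₂ BC K) K) (edges-b ++ edges-c)

        complete₂ : ∀ w → InN Q w × Adj v₂ w → w ∈ upperList
        complete₂ w ((w∈S , w∉Q* , u , u∈Q* , u-adj) , adj) with w∈S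
        ... | k , l , vK , z , z≢ε , refl with adjacent⇒linked vBC vK z₂≢ε z≢ε adj
        ...   | inj₁ (refl , z₂≢z) with member-on-star u∈Q*
        ...     | s , rs , s≢a , refl with adjacent⇒linked (σ-valid rs s≢a) vBC (σ≢ε s) z≢ε u-adj
        ...       | inj₁ (as≡BC , _) = ⊥-elim (a∉BC (subst (λ K → IsEndpoint K a) as≡BC (edge-endpointˡ a s)))
        ...       | inj₂ (touch , z≡) with edge-endpoint⁻ (touching-edge-other touch a∉BC)
        ...         | inj₁ refl = ⊥-elim (z₂≢z (trans (cong (λ x → transport x AB BC) (sym (transport-refl x₀ AB))) (sym z≡)))
        ...         | inj₂ refl = ⊥-elim (z₂≢z (trans (sym z₂⁻¹≡z₂) (trans (sym z₂⁻¹≡) (sym z≡))))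
        complete₂ w ((w∈S , w∉Q* , u , u∈Q* , u-adj) , adj) | k , l , vK , z , z≢ε , refl | inj₂ (touch , refl)
          with isEndpoint? (k , l) a
        ... | yes a∈K with as-edge vK a∈K
        ...   | t , t≢a , rt , refl with touching-edge touch
        ...     | inj₁ b∈K with edge-endpoint⁻ b∈K
        ...       | inj₁ b≡a = ⊥-elim (a≢b (sym b≡a))
        ...       | inj₂ refl = ⊥-elim (w∉Q* (subst (λ x → InQ* Q (vec x AB)) (sym (transport-involutive x₀ AB BC)) u₀∈Q*))
        complete₂ w ((w∈S , w∉Q* , u , u∈Q* , u-adj) , adj) | k , l , vK , z , z≢ε , refl | inj₂ (touch , refl)
          | yes a∈K | t , t≢a , rt , refl | inj₂ c∈K with edge-endpoint⁻ c∈K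
        ... | inj₁ c≡a = ⊥-elim (a≢c (sym c≡a))
        ... | inj₂ refl = ⊥-elim (w∉Q* (subst (λ x → InQ* Q (vec x AC)) y₀≡ v₀∈Q*))
          where
            y₀≡ : y₀ ≡ transport z₂ BC AC
            y₀≡ = begin
              y₀                                   ≡⟨ sym (transport-involutive y₀ AC BC) ⟩
              transport (transport y₀ AC BC) BC AC ≡⟨ cong (λ x → transport x BC AC) (trans z₂⁻¹≡ z₂⁻¹≡z₂) ⟩
              transport z₂ BC AC                   ∎
              where open ≡-Reasoning
        complete₂ w _ | k , l , vK , z , z≢ε , refl | inj₂ (touch , refl) | no a∉K with touching-edge touch
        ... | inj₁ b∈K with as-edge vK b∈K
        ...   | t , t≢b , rt , refl = ∈-map⁺ _ (∈-++⁺ˡ (∈-map⁺ (edge b)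
                  (∈-pointsExcept₃⁺ rt (λ { refl → a∉K (edge-endpointʳ b t) }) t≢b (λ { refl → proj₂ touch refl }))))
        complete₂ w _ | k , l , vK , z , z≢ε , refl | inj₂ (touch , refl) | no a∉K | inj₂ c∈K with as-edge vK c∈K
        ...   | t , t≢c , rt , refl = ∈-map⁺ _ (∈-++⁺ʳ edges-b (∈-map⁺ (edge c)
                  (∈-pointsExcept₃⁺ rt (λ { refl → a∉K (edge-endpointʳ c t) }) (λ { refl → proj₂ touch (edge-comm b c) }) t≢c)))

        degree≤ : ∀ {d} → DegreeInN Q v₂ d → d ≤ length rest + length rest
        degree≤ size = subst (_ ≤_) (trans (length-map _ (edges-b ++ edges-c)) length-edges)
                         (VertexCounting.size≤length size upperList complete₂)

      -- Writing r = |rest|, so that m = r + 2: y_{ab} has degree 2r + 1, while z₂_{bc} has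
      -- degree at least 2r + 2 or at most 2r, according as x₀² ≠ e or x₀² = e.
      not-regular : ∀ {y} → y ≢ ε → y ≢ x₀ → y ≢ x₀ ⁻¹ → ¬ RegularN Q
      not-regular y≢ε y≢x₀ y≢x₀⁻¹ (d , regular) = by-order (x₀ Fin.≟ x₀ ⁻¹)
        where
          open V₁ y≢ε y≢x₀ y≢x₀⁻¹
          open ≤-Reasoning
          by-order : Dec (x₀ ≡ x₀ ⁻¹) → ⊥
          by-order (no x₀≢x₀⁻¹) = 1+n≰n (begin
            suc (length rest) + suc (length rest)  ≤⟨ V₂-lower.degree≥ x₀≢x₀⁻¹ (regular v₂ v₂∈N) ⟩
            d                                      ≤⟨ degree≤ (regular v₁ v₁∈N) ⟩
            length rest + suc (length rest)        ∎)
          by-order (yes x₀≡x₀⁻¹) = 1+n≰n (begin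
            suc (length rest + length rest)        ≡⟨ sym (+-suc (length rest) (length rest)) ⟩
            length rest + suc (length rest)        ≡⟨ cong (length rest +_) (sym length-Ks₁) ⟩
            length rest + length Ks₁               ≤⟨ degree≥ (regular v₁ v₁∈N) ⟩
            d                                      ≤⟨ V₂-upper.degree≤ x₀≡x₀⁻¹ (regular v₂ v₂∈N) ⟩
            length rest + length rest              ∎)

    -- In the triangle case m = 3, so exactly one point d lies outside {a, b, c}.
    fourth-point : w₃ ∈ Q → m ≤ length members → 3 ≤ m →
      ∃[ d ] (InRange d × d ≢ a × d ≢ b × d ≢ c) × (∀ {t} → InRange t → t ≢ a → t ≢ b → t ≢ c → t ≡ d)
    fourth-point w₃∈Q m≤|members| 3≤m = the-only rest |rest|≡1 ∈-pointsExcept₃⁻ ∈-pointsExcept₃⁺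
      where
        m≤3 : m ≤ 3
        m≤3 = ≤-trans m≤|members|
                (VertexCounting.unique⊆⇒length≤ members (u₀ ∷ v₀ ∷ w₃ ∷ []) unique-members (members⊆triangle w₃∈Q))
        |rest|≡1 : length rest ≡ 1
        |rest|≡1 = ≤-antisym (≤-pred (≤-pred (subst (_≤ 3) m≡2+|rest| m≤3))) (≤-pred (≤-pred (subst (3 ≤_) m≡2+|rest| 3≤m)))
        the-only : (xs : List ℕ) → length xs ≡ 1 → (∀ {t} → t ∈ xs → InRange t × t ≢ a × t ≢ b × t ≢ c) →
          (∀ {t} → InRange t → t ≢ a → t ≢ b → t ≢ c → t ∈ xs) →
          ∃[ d ] (InRange d × d ≢ a × d ≢ b × d ≢ c) × (∀ {t} → InRange t → t ≢ a → t ≢ b → t ≢ c → t ≡ d)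
        the-only (d ∷ []) _ ∈xs⁻ ∈xs⁺ = d , ∈xs⁻ (here refl) , λ rt t≢a t≢b t≢c → the-head (∈xs⁺ rt t≢a t≢b t≢c)
          where
            the-head : ∀ {t} → t ∈ d ∷ [] → t ≡ d
            the-head (here t≡d) = t≡d

    module Triangle (w₃∈Q : w₃ ∈ Q) {d : ℕ} (rd : InRange d) (d≢a : d ≢ a) (d≢b : d ≢ b) (d≢c : d ≢ c)
                    (only-d : ∀ {t} → InRange t → t ≢ a → t ≢ b → t ≢ c → t ≡ d) where

      AD : Interval
      AD = edge a d

      vAD : Valid AD
      vAD = edge-valid ra rd (d≢a ∘′ sym)

      zd : C
      zd = transport x₀ AB AD

      zd≢ε : zd ≢ ε
      zd≢ε = transport≢ε AB AD x₀≢ε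

      zd≡ : transport y₀ AC AD ≡ zd
      zd≡ = transport-trans x₀ a≢b a≢c (d≢a ∘′ sym)

      v₂ : Vtx
      v₂ = vec zd AD

      v₂∉Q* : ¬ InQ* Q v₂
      v₂∉Q* v₂∈Q* with members⊆triangle w₃∈Q (∈-members⁺ v₂∈Q*)
      ... | here eq = d≢b (edge-injectiveʳ (d≢a) (proj₂ (vec-injective vAD vAB zd≢ε eq)))
      ... | there (here eq) = d≢c (edge-injectiveʳ (d≢a) (proj₂ (vec-injective vAD vAC zd≢ε eq)))
      ... | there (there (here eq)) = a∉BC (subst (λ K → IsEndpoint K a) (proj₂ (vec-injective vAD vBC zd≢ε eq)) (edge-endpointˡ a d))

      v₂∈N : InN Q v₂
      v₂∈N = vec∈S vAD zd≢ε , v₂∉Q* , u₀ , u₀∈Q* ,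
             linked⇒adjacent vAB vAD x₀≢ε (inj₂ (edges-touching a≢b (d≢b ∘′ sym) , refl))

      upperList : List Vtx
      upperList = vec (transport zd AD (edge d b)) (edge d b) ∷ vec (transport zd AD (edge d c)) (edge d c) ∷ []

      complete₂ : ∀ w → InN Q w × Adj v₂ w → w ∈ upperList
      complete₂ w ((w∈S , w∉Q* , u , u∈Q* , u-adj) , adj) with w∈S
      ... | k , l , vK , z , z≢ε , refl with adjacent⇒linked vAD vK zd≢ε z≢ε adj
      ...   | inj₁ (refl , zd≢z) = ⊥-elim (relabelling-not-in-N (members⊆triangle w₃∈Q (∈-members⁺ u∈Q*)))
        where
          relabelling-not-in-N : u ∈ u₀ ∷ v₀ ∷ w₃ ∷ [] → ⊥
          relabelling-not-in-N (here refl) with adjacent⇒linked vAB vAD x₀≢ε z≢ε u-adj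
          ... | inj₁ (AB≡AD , _) = proj₂ (edges-touching a≢b (d≢b ∘′ sym)) AB≡AD
          ... | inj₂ (_ , z≡) = zd≢z (sym z≡)
          relabelling-not-in-N (there (here refl)) with adjacent⇒linked vAC vAD y₀≢ε z≢ε u-adj
          ... | inj₁ (AC≡AD , _) = proj₂ (edges-touching a≢c (d≢c ∘′ sym)) AC≡AD
          ... | inj₂ (_ , z≡) = zd≢z (sym (trans z≡ zd≡))
          relabelling-not-in-N (there (there (here refl))) with adjacent⇒linked vBC vAD z₂≢ε z≢ε u-adj
          ... | inj₁ (BC≡AD , _) = a∉BC (subst (λ K → IsEndpoint K a) (sym BC≡AD) (edge-endpointˡ a d))
          ... | inj₂ (touch , _) with touching-edge touch
          ...   | inj₁ b∈AD = ∉-edge a≢b (d≢b) b∈AD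
          ...   | inj₂ c∈AD = ∉-edge a≢c (d≢c) c∈AD
      ...   | inj₂ (touch , refl) with isEndpoint? (k , l) a
      ...     | yes a∈K with as-edge vK a∈K
      ...       | t , t≢a , rt , refl with t ≟ b | t ≟ c
      ...         | yes refl | _ = ⊥-elim (w∉Q* (subst (λ x → InQ* Q (vec x AB)) (sym (transport-involutive x₀ AB AD)) u₀∈Q*))
      ...         | no _ | yes refl = ⊥-elim (w∉Q* (subst (λ x → InQ* Q (vec x AC))
                      (trans (sym (transport-involutive y₀ AC AD)) (cong (λ x → transport x AD AC) zd≡)) v₀∈Q*))
      ...         | no t≢b | no t≢c = ⊥-elim (proj₂ touch (cong (edge a) (sym (only-d rt t≢a t≢b t≢c))))
      complete₂ w ((w∈S , w∉Q* , u , u∈Q* , u-adj) , adj) | k , l , vK , z , z≢ε , refl | inj₂ (touch , refl) | no a∉K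
        with as-edge vK (touching-edge-other touch a∉K)
      ... | t , t≢d , rt , refl with t ≟ b | t ≟ c
      ...   | yes refl | _ = here refl
      ...   | no _ | yes refl = there (here refl)
      ...   | no t≢b | no t≢c = ⊥-elim (t≢d (only-d rt (λ { refl → a∉K (edge-endpointʳ d t) }) t≢b t≢c))

      triangle-sides : List Interval
      triangle-sides = AC ∷ BC ∷ []

      unique-triangle-sides : Unique triangle-sides
      unique-triangle-sides = (proj₂ AC-touches-BC ∷ []) ∷ [] ∷ []

      triangle-sides-ok : ∀ {K} → K ∈ triangle-sides → Valid K × Touching AB K × vec (transport x₀ AB K) K ∈ Q
      triangle-sides-ok (here refl) = vAC , edges-touching a≢b b≢c , v₀∈Q
      triangle-sides-ok (there (here refl)) = vBC , AB-touches-BC , w₃∈Q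

      not-regular : 3 ≤ m → ∀ {y} → y ≢ ε → y ≢ x₀ → ¬ RegularN Q
      not-regular 3≤m y≢ε y≢x₀ (deg , regular) = 1+n≰n (begin
        3                                        ≤⟨ subst (3 ≤_) (trans m≡2+|rest| (+-comm 2 (length rest))) 3≤m ⟩
        length rest + length triangle-sides      ≤⟨ degree≥ (regular v₁ v₁∈N) ⟩
        deg                                      ≤⟨ VertexCounting.size≤length (regular v₂ v₂∈N) upperList complete₂ ⟩
        2                                        ∎)
        where
          open ≤-Reasoning
          open AroundAB y≢ε y≢x₀ triangle-sides unique-triangle-sides triangle-sides-ok

    not-regular : m ≤ length members → 3 ≤ m → ∀ {y} → y ≢ ε → y ≢ x₀ → y ≢ x₀ ⁻¹ → ¬ RegularN Q
    not-regular m≤|members| 3≤m y≢ε y≢x₀ y≢x₀⁻¹ with VertexCounting._∈?_ w₃ Q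
    ... | no w₃∉Q = Star.not-regular w₃∉Q m≤|members| y≢ε y≢x₀ y≢x₀⁻¹
    ... | yes w₃∈Q with fourth-point w₃∈Q m≤|members| 3≤m
    ...   | _ , (rd , d≢a , d≢b , d≢c) , only-d = Triangle.not-regular w₃∈Q rd d≢a d≢b d≢c only-d 3≤m y≢ε y≢x₀

  maximum-dispersed-not-regular : 3 ≤ m → ∀ Q → MaxDispersedClique Q → ¬ RegularN Q
  maximum-dispersed-not-regular 3≤m Q ((clique , _ , _ , k , l , k′ , l′ , (u∈Q , _) , (v∈Q , _) , vI , vJ ,
                                         (x₀ , x₀≢ε , refl) , (y₀ , y₀≢ε , refl) , I≢J) , maximal)
    with Clique.members-linked Q clique vI vJ x₀≢ε y₀≢ε u∈Q v∈Q (I≢J ∘′ ×-≡,≡←≡ ∘′ proj₂ ∘′ vec-injective vI vJ x₀≢ε)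
  ... | inj₁ (I≡J , _) = ⊥-elim (I≢J (×-≡,≡←≡ I≡J))
  ... | inj₂ (((p , p∈I , p∈J) , I≢J) , refl) with as-edge vI p∈I | as-edge vJ p∈J
  ...   | b , b≢p , rb , refl | c , c≢p , rc , refl =
    TwoMembers.not-regular Q clique (endpoint-inRange vI p∈I) rb rc (b≢p ∘′ sym) (c≢p ∘′ sym) (λ { refl → I≢J refl })
      x₀≢ε u∈Q v∈Q m≤|members| 3≤m y≢ε y≢x₀ y≢x₀⁻¹
    where
      m≤|members| : m ≤ length (Clique.members Q clique)
      m≤|members| = ≤-pred (subst₂ _≤_ (length-starClique x₀) (sym (Clique.length-members Q clique))
                              (maximal (starClique x₀) (starClique-isDispersed (<⇒≤ 3≤m) x₀≢ε)))
      2<|nonIdentity| : 2 < length nonIdentity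
      2<|nonIdentity| = subst (2 <_) (sym length-nonIdentity) 3≤m
      another-label = LabelCounting.longer⇒∃∉ nonIdentity (x₀ ∷ x₀ ⁻¹ ∷ []) unique-nonIdentity 2<|nonIdentity|
      y = proj₁ another-label
      y≢ε = ∈-nonIdentity⁻ (proj₁ (proj₂ another-label))
      y≢x₀ = proj₂ (proj₂ another-label) ∘′ here
      y≢x₀⁻¹ = proj₂ (proj₂ another-label) ∘′ there ∘′ here

proposition4p8 : (m : ℕ) (G : FinGroup (suc m)) → 3 < suc m →
    ((Q : List (Vec (Fin (suc m)) m)) →
      Graph.MaxDispersedClique G m Q → ¬ Graph.RegularN G m Q)
    ×
    ((Q : List (Vec (Fin (suc m)) m)) →
      Graph.MaxIntervalClique G m Q → Graph.RegularOfDegree G m Q (2 * m ∸ 2))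
proposition4p8 m G 3<1+m =
  DispersedCliques.maximum-dispersed-not-regular m G (≤-pred 3<1+m) ,
  λ Q maximum → IntervalCliques.MaximumIntervalClique.regular m G Q maximum
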